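{- For every formula $P(x_1,\dots,x_n)$ of the language of $\mathrm{Z}_{st}$, the universal closure of $$\bigwedge_{i=1}^n\mathrm{Reif}(g_i,x_i)\ \Rightarrow\ \bigl(P(x_1,\dots,x_n)\Leftrightarrow P^{\dagger*}(g_1,\dots,g_n)\bigr)$$ is a theorem of $\mathrm{Z}_{skol}$.
   Context: $\mathrm{Z}_{st}$ is intuitionistic Zermelo set theory with Strong Extensionality and Transitive Closure, in the language $\{=,\in\}$: equality axioms ($=$ reflexive, $x=x'\land x=y\Rightarrow x'=y$, $=$ compatible with $\in$ on both sides), the Strong Extensionality scheme $\forall a\forall b(R(a,b)\land\forall x\forall x'\forall y(x'\in x\land R(x,y)\Rightarrow\exists y'(y'\in y\land R(x',y')))\land\forall y\forall y'\forall x(y'\in y\land R(x,y)\Rightarrow\exists x'(x'\in x\land R(x',y')))\Rightarrow a=b)$ for every formula $R$ with parameters, Pairing, Union, Powerset, Restricted Comprehension, Infinity, and Transitive Closure $\forall a\exists e(a\subseteq e\land\forall x\forall y(x\in y\land y\in e\Rightarrow x\in e))$. $\mathrm{Z}_{skol}$ is its conservative extension by a sort of classes with predicative class comprehension and by Skolem terms ($\{t_1,t_2\}$, $\bigcup t$, $\mathcal P(t)$, $\{x\in t\mid P\}$, $\mathbb N$, $\mathrm{Cl}(t)$); all notations below are definable in it. Notation: $\langle a,b\rangle=\{\{a\},\{a,b\}\}$ with projections $\pi_1,\pi_2$. A graph is a set all of whose elements are ordered pairs ($\mathrm{Graph}(A)$); $\mathrm{Car}(A)=\{x\in\bigcup\bigcup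 A\mid\exists y\,(\langle x,y\rangle\in A\lor\langle y,x\rangle\in A)\}$. A function $\phi$ is a set of ordered pairs with $\langle x,y\rangle,\langle x,y'\rangle\in\phi\Rightarrow y=y'$; $\mathrm{Dom}(\phi)$, $\mathrm{Cod}(\phi)$ are its sets of first and second components; $\phi(i)$ is the $y$ with $\langle i,y\rangle\in\phi$. $\mathrm{Collapse}(A,\phi)$ means: $A$ is a graph, $\phi$ is a function, $\mathrm{Dom}(\phi)=\mathrm{Car}(A)$, and for every $i\in\mathrm{Dom}(\phi)$ and every $x$: $x\in\phi(i)$ iff there is $j\in\mathrm{Dom}(\phi)$ with $\langle j,i\rangle\in A$ and $x=\phi(j)$. $\hat\phi_A(i)=\{y\in\mathrm{Cod}(\phi)\mid\exists j\,(\langle j,i\rangle\in A\land\langle j,y\rangle\in\phi)\}$. $\mathrm{Reif}(g,x)$ (``$x$ is a reification of the pointed graph $g$'') is $\exists A\exists a\exists\phi\,(g=\langle A,a\rangle\land\mathrm{Collapse}(A,\phi)\land x=\hat\phi_A(a))$; $\mathrm{Rgraph}(g)\equiv\exists x\,\mathrm{Reif}(g,x)$. Bisimilarity: $g\approx g'$ is $\exists A\exists a\exists B\exists b\exists r\,(\mathrm{Graph}(A)\land\mathrm{Graph}(B)\land g=\langle A,a\rangle\land g'=\langle B,b\rangle\land\langle a,b\rangle\in r\land\forall x\forall x'\forall y((\langle x',x\rangle\in A\land\langle x,y\rangle\in r)\Rightarrow\exists y'(\langle y',y\rangle\in B\land\langle x',y'\rangle\in r))\land\forall y\forall y'\forall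 x((\langle y',y\rangle\in B\land\langle x,y\rangle\in r)\Rightarrow\exists x'(\langle x',x\rangle\in A\land\langle x',y'\rangle\in r)))$. For a formula $P(x_1,\dots,x_n)$ of $\mathrm{Z}_{st}$, the set-theoretic formula $P^{\dagger*}(g_1,\dots,g_n)$ (variables $x$ replaced by variables $g$) is defined by: $(x=y)^{\dagger*}\equiv g\approx h$; $(x\in y)^{\dagger*}\equiv\exists z\,(\langle z,\pi_2(h)\rangle\in\pi_1(h)\land g\approx\langle\pi_1(h),z\rangle)$ (where $g,h$ replace $x,y$); $\top,\bot$ and connectives $\land,\lor,\Rightarrow$ are preserved; $(\forall x\,Q)^{\dagger*}\equiv\forall g\,(\mathrm{Rgraph}(g)\Rightarrow Q^{\dagger*})$; $(\exists x\,Q)^{\dagger*}\equiv\exists g\,(\mathrm{Rgraph}(g)\land Q^{\dagger*})$. -}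

module Defs where

open import Data.Nat using (ℕ; zero; suc; _+_)
open import Data.Fin using (Fin; zero; suc; _↑ˡ_; _↑ʳ_)
open import Data.List using (List; []; _∷_; map)
open import Data.List.Membership.Propositional renaming (_∈_ to _∈ₗ_)

-- Formulas (de Bruijn, scoped by the number of free variables).
-- Variable zero is the most recently bound one.

infix  8 _≐_ _∈̇_
infixr 6 _∧̇_
infixr 5 _∨̇_
infixr 4 _⇒̇_
infix  3 _⇔̇_
infixr 9 ∀̇_ ∃̇_ ¬̇_

data Fm : ℕ → Set where
  _≐_ _∈̇_   : ∀ {n} → Fin n → Fin n → Fm n
  ⊤̇ ⊥̇       : ∀ {n} → Fm n
  _∧̇_ _∨̇_ _⇒̇_ : ∀ {n} → Fm n → Fm n → Fm n
  ∀̇_ ∃̇_     : ∀ {n} → Fm (suc n) → Fm n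

_⇔̇_ : ∀ {n} → Fm n → Fm n → Fm n
A ⇔̇ B = (A ⇒̇ B) ∧̇ (B ⇒̇ A)

¬̇_ : ∀ {n} → Fm n → Fm n
¬̇ A = A ⇒̇ ⊥̇

ext : ∀ {n m} → (Fin n → Fin m) → Fin (suc n) → Fin (suc m)
ext ρ zero    = zero
ext ρ (suc i) = suc (ρ i)

ren : ∀ {n m} → (Fin n → Fin m) → Fm n → Fm m
ren ρ (x ≐ y)  = ρ x ≐ ρ y
ren ρ (x ∈̇ y)  = ρ x ∈̇ ρ y
ren ρ ⊤̇        = ⊤̇
ren ρ ⊥̇        = ⊥̇
ren ρ (A ∧̇ B)  = ren ρ A ∧̇ ren ρ B
ren ρ (A ∨̇ B)  = ren ρ A ∨̇ ren ρ B
ren ρ (A ⇒̇ B)  = ren ρ A ⇒̇ ren ρ B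
ren ρ (∀̇ A)    = ∀̇ (ren (ext ρ) A)
ren ρ (∃̇ A)    = ∃̇ (ren (ext ρ) A)

wk : ∀ {n} → Fm n → Fm (suc n)
wk = ren suc

inst : ∀ {n} → Fm (suc n) → Fin n → Fm n
inst A x = ren (λ { zero → x ; (suc i) → i }) A

fromClosed : ∀ {n} → Fm 0 → Fm n
fromClosed = ren (λ ())

closeAll : ∀ n → Fm n → Fm 0
closeAll zero    A = A
closeAll (suc n) A = closeAll n (∀̇ A)

⋀ : ∀ {n m} → (Fin n → Fm m) → Fm m
⋀ {zero}  f = ⊤̇
⋀ {suc n} f = f zero ∧̇ ⋀ (λ i → f (suc i))

module Deduction (Ax : Fm 0 → Set) where

  infix 2 _⊢_
  data _⊢_ : ∀ {n} → List (Fm n) → Fm n → Set where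
    hyp  : ∀ {n} {Γ : List (Fm n)} {A} → A ∈ₗ Γ → Γ ⊢ A
    ax   : ∀ {n} {Γ : List (Fm n)} {A} → Ax A → Γ ⊢ fromClosed A
    ⊤I   : ∀ {n} {Γ : List (Fm n)} → Γ ⊢ ⊤̇
    ⊥E   : ∀ {n} {Γ : List (Fm n)} {A} → Γ ⊢ ⊥̇ → Γ ⊢ A
    ∧I   : ∀ {n} {Γ : List (Fm n)} {A B} → Γ ⊢ A → Γ ⊢ B → Γ ⊢ A ∧̇ B
    ∧E₁  : ∀ {n} {Γ : List (Fm n)} {A B} → Γ ⊢ A ∧̇ B → Γ ⊢ A
    ∧E₂  : ∀ {n} {Γ : List (Fm n)} {A B} → Γ ⊢ A ∧̇ B → Γ ⊢ B
    ∨I₁  : ∀ {n} {Γ : List (Fm n)} {A B} → Γ ⊢ A → Γ ⊢ A ∨̇ B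
    ∨I₂  : ∀ {n} {Γ : List (Fm n)} {A B} → Γ ⊢ B → Γ ⊢ A ∨̇ B
    ∨E   : ∀ {n} {Γ : List (Fm n)} {A B C} →
           Γ ⊢ A ∨̇ B → (A ∷ Γ) ⊢ C → (B ∷ Γ) ⊢ C → Γ ⊢ C
    ⇒I   : ∀ {n} {Γ : List (Fm n)} {A B} → (A ∷ Γ) ⊢ B → Γ ⊢ A ⇒̇ B
    ⇒E   : ∀ {n} {Γ : List (Fm n)} {A B} → Γ ⊢ A ⇒̇ B → Γ ⊢ A → Γ ⊢ B
    ∀I   : ∀ {n} {Γ : List (Fm n)} {A} → map wk Γ ⊢ A → Γ ⊢ ∀̇ A
    ∀E   : ∀ {n} {Γ : List (Fm n)} {A} → Γ ⊢ ∀̇ A → (x : Fin n) → Γ ⊢ inst A x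
    ∃I   : ∀ {n} {Γ : List (Fm n)} {A} → (x : Fin n) → Γ ⊢ inst A x → Γ ⊢ ∃̇ A
    ∃E   : ∀ {n} {Γ : List (Fm n)} {A C} →
           Γ ⊢ ∃̇ A → (A ∷ map wk Γ) ⊢ wk C → Γ ⊢ C

  Theorem : Fm 0 → Set
  Theorem A = [] ⊢ A

v0 : ∀ {n} → Fin (suc n)
v0 = zero
v1 : ∀ {n} → Fin (suc (suc n))
v1 = suc zero
v2 : ∀ {n} → Fin (suc (suc (suc n)))
v2 = suc v1
v3 : ∀ {n} → Fin (suc (suc (suc (suc n))))
v3 = suc v2
v4 : ∀ {n} → Fin (suc (suc (suc (suc (suc n)))))
v4 = suc v3
v5 : ∀ {n} → Fin (suc (suc (suc (suc (suc (suc n))))))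
v5 = suc v4
v6 : ∀ {n} → Fin (suc (suc (suc (suc (suc (suc (suc n)))))))
v6 = suc v5
v7 : ∀ {n} → Fin (suc (suc (suc (suc (suc (suc (suc (suc n))))))))
v7 = suc v6

↑ : ∀ d {n} → Fin n → Fin (d + n)
↑ d i = d ↑ʳ i

app2 : ∀ {k m} → Fm (suc (suc k)) → (Fin k → Fin m) → Fin m → Fin m → Fm m
app2 R ρ u w = ren (λ { zero → u ; (suc zero) → w ; (suc (suc i)) → ρ i }) R

app1 : ∀ {k m} → Fm (suc k) → (Fin k → Fin m) → Fin m → Fm m
app1 P ρ u = ren (λ { zero → u ; (suc i) → ρ i }) P

StrongExt : ∀ k → Fm (suc (suc k)) → Fm k
StrongExt k R =
  ∀̇ ∀̇ (  -- a = v1, b = v0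
    (  app2 R (↑ 2) v1 v0
    ∧̇ ∀̇ ∀̇ ∀̇ (  -- x = v2, x' = v1, y = v0
         (v1 ∈̇ v2 ∧̇ app2 R (↑ 5) v2 v0)
         ⇒̇ ∃̇ (v0 ∈̇ v1 ∧̇ app2 R (↑ 6) v2 v0))   -- y' = v0, y = v1, x' = v2
    ∧̇ ∀̇ ∀̇ ∀̇ (  -- y = v2, y' = v1, x = v0
         (v1 ∈̇ v2 ∧̇ app2 R (↑ 5) v0 v2)
         ⇒̇ ∃̇ (v0 ∈̇ v1 ∧̇ app2 R (↑ 6) v0 v2)))  -- x' = v0, x = v1, y' = v2
    ⇒̇ v1 ≐ v0)

Compr : ∀ k → Fm (suc k) → Fm k
Compr k P = ∀̇ ∃̇ ∀̇ ((v0 ∈̇ v1) ⇔̇ (v0 ∈̇ v2 ∧̇ app1 P (↑ 3) v0))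

data ZstAx : Fm 0 → Set where
  eq-refl  : ZstAx (∀̇ (v0 ≐ v0))
  eq-eucl  : ZstAx (∀̇ ∀̇ ∀̇ ((v2 ≐ v1 ∧̇ v2 ≐ v0) ⇒̇ v1 ≐ v0))          -- x=x' ∧ x=y ⇒ x'=y
  eq-∈ˡ    : ZstAx (∀̇ ∀̇ ∀̇ ((v2 ≐ v1 ∧̇ v2 ∈̇ v0) ⇒̇ v1 ∈̇ v0))          -- x=x' ∧ x∈y ⇒ x'∈y
  eq-∈ʳ    : ZstAx (∀̇ ∀̇ ∀̇ ((v1 ≐ v0 ∧̇ v2 ∈̇ v1) ⇒̇ v2 ∈̇ v0))          -- y=y' ∧ x∈y ⇒ x∈y'
  strong-ext : ∀ k (R : Fm (suc (suc k))) → ZstAx (closeAll k (StrongExt k R))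
  -- Pairing: ∀a∀b∃c∀x (x∈c ⇔ x=a ∨ x=b)
  pairing  : ZstAx (∀̇ ∀̇ ∃̇ ∀̇ ((v0 ∈̇ v1) ⇔̇ (v0 ≐ v3 ∨̇ v0 ≐ v2)))
  -- Union: ∀a∃u∀x (x∈u ⇔ ∃y (y∈a ∧ x∈y))
  union    : ZstAx (∀̇ ∃̇ ∀̇ ((v0 ∈̇ v1) ⇔̇ ∃̇ (v0 ∈̇ v3 ∧̇ v1 ∈̇ v0)))
  -- Powerset: ∀a∃p∀x (x∈p ⇔ ∀y (y∈x ⇒ y∈a))
  powerset : ZstAx (∀̇ ∃̇ ∀̇ ((v0 ∈̇ v1) ⇔̇ ∀̇ (v0 ∈̇ v1 ⇒̇ v0 ∈̇ v3)))
  compr    : ∀ k (P : Fm (suc k)) → ZstAx (closeAll k (Compr k P))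
  -- Infinity: ∃I (∃e (e∈I ∧ ∀y ¬ y∈e) ∧ ∀x (x∈I ⇒ ∃s (s∈I ∧ ∀z (z∈s ⇔ z∈x ∨ z=x))))
  infinity : ZstAx (∃̇ ( ∃̇ (v0 ∈̇ v1 ∧̇ ∀̇ (¬̇ (v0 ∈̇ v1)))
                      ∧̇ ∀̇ (v0 ∈̇ v1 ⇒̇ ∃̇ (v0 ∈̇ v2 ∧̇
                              ∀̇ ((v0 ∈̇ v1) ⇔̇ (v0 ∈̇ v2 ∨̇ v0 ≐ v2))))))
  -- Transitive Closure: ∀a∃e (a ⊆ e ∧ ∀x∀y (x∈y ∧ y∈e ⇒ x∈e))
  trans-cl : ZstAx (∀̇ ∃̇ ( ∀̇ (v0 ∈̇ v2 ⇒̇ v0 ∈̇ v1)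
                         ∧̇ ∀̇ ∀̇ ((v1 ∈̇ v0 ∧̇ v0 ∈̇ v2) ⇒̇ v1 ∈̇ v2)))

open Deduction ZstAx public

-- Derived notions, unfolded into {=,∈}-formulas.
-- Definitional terms t are rendered extensionally (x = t as
-- "∀y (y ∈ x ⇔ y ∈ t)"), membership in a term by its defining property.

IsSing : ∀ {n} → Fin n → Fin n → Fm n
IsSing w a = ∀̇ ((v0 ∈̇ suc w) ⇔̇ (v0 ≐ suc a))

IsDoub : ∀ {n} → Fin n → Fin n → Fin n → Fm n
IsDoub w a b = ∀̇ ((v0 ∈̇ suc w) ⇔̇ (v0 ≐ suc a ∨̇ v0 ≐ suc b))

IsPair : ∀ {n} → Fin n → Fin n → Fin n → Fm n
IsPair u a b = ∀̇ ((v0 ∈̇ suc u) ⇔̇ (IsSing v0 (suc a) ∨̇ IsDoub v0 (suc a) (suc b)))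

PairIn : ∀ {n} → Fin n → Fin n → Fin n → Fm n
PairIn a b A = ∃̇ (IsPair v0 (suc a) (suc b) ∧̇ v0 ∈̇ suc A)

Graph : ∀ {n} → Fin n → Fm n
Graph A = ∀̇ (v0 ∈̇ suc A ⇒̇ ∃̇ ∃̇ (IsPair v2 v1 v0))

Func : ∀ {n} → Fin n → Fm n
Func φ = Graph φ ∧̇ ∀̇ ∀̇ ∀̇ ((PairIn v2 v1 (↑ 3 φ) ∧̇ PairIn v2 v0 (↑ 3 φ)) ⇒̇ v1 ≐ v0)

InDom : ∀ {n} → Fin n → Fin n → Fm n
InDom x φ = ∃̇ (PairIn (suc x) v0 (suc φ))

InCod : ∀ {n} → Fin n → Fin n → Fm n
InCod y φ = ∃̇ (PairIn v0 (suc y) (suc φ))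

-- x ∈ Car(A) = {x ∈ ⋃⋃A | ∃y (⟨x,y⟩ ∈ A ∨ ⟨y,x⟩ ∈ A)}
InCar : ∀ {n} → Fin n → Fin n → Fm n
InCar x A =
  ∃̇ ∃̇ (v1 ∈̇ ↑ 2 A ∧̇ v0 ∈̇ v1 ∧̇ ↑ 2 x ∈̇ v0)
  ∧̇ ∃̇ (PairIn (suc x) v0 (suc A) ∨̇ PairIn v0 (suc x) (suc A))

InApp : ∀ {n} → Fin n → Fin n → Fin n → Fm n
InApp x φ i = ∃̇ (PairIn (suc i) v0 (suc φ) ∧̇ suc x ∈̇ v0)

EqApp : ∀ {n} → Fin n → Fin n → Fin n → Fm n
EqApp x φ j = ∃̇ (PairIn (suc j) v0 (suc φ) ∧̇ suc x ≐ v0)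

Collapse : ∀ {n} → Fin n → Fin n → Fm n
Collapse A φ =
  Graph A ∧̇ Func φ
  ∧̇ ∀̇ (InDom v0 (suc φ) ⇔̇ InCar v0 (suc A))
  ∧̇ ∀̇ (InDom v0 (suc φ) ⇒̇                      -- i = v0
        ∀̇ (InApp v0 (↑ 2 φ) v1 ⇔̇               -- x = v0, i = v1
            ∃̇ (InDom v0 (↑ 3 φ) ∧̇ PairIn v0 v2 (↑ 3 A) ∧̇ EqApp v1 (↑ 3 φ) v0)))
                                                 -- j = v0, x = v1, i = v2

-- x = φ̂_A(a) = {y ∈ Cod(φ) | ∃j (⟨j,a⟩ ∈ A ∧ ⟨j,y⟩ ∈ φ)}
EqHat : ∀ {n} → Fin n → Fin n → Fin n → Fin n → Fm n
EqHat x φ A a =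
  ∀̇ ((v0 ∈̇ suc x) ⇔̇
      (InCod v0 (suc φ) ∧̇ ∃̇ (PairIn v0 (↑ 2 a) (↑ 2 A) ∧̇ PairIn v0 v1 (↑ 2 φ))))

Reif : ∀ {n} → Fin n → Fin n → Fm n
Reif g x = ∃̇ ∃̇ ∃̇ (   -- A = v2, a = v1, φ = v0
  IsPair (↑ 3 g) v2 v1 ∧̇ Collapse v2 v0 ∧̇ EqHat (↑ 3 x) v0 v2 v1)

Rgraph : ∀ {n} → Fin n → Fm n
Rgraph g = ∃̇ (Reif (suc g) v0)

Bisim : ∀ {n} → Fin n → Fin n → Fm n
Bisim g g' = ∃̇ ∃̇ ∃̇ ∃̇ ∃̇ (   -- A = v4, a = v3, B = v2, b = v1, r = v0
     Graph v4 ∧̇ Graph v2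
  ∧̇ IsPair (↑ 5 g) v4 v3 ∧̇ IsPair (↑ 5 g') v2 v1
  ∧̇ PairIn v3 v1 v0
  ∧̇ ∀̇ ∀̇ ∀̇ (   -- x = v2, x' = v1, y = v0 ; A = v7, B = v5, r = v3
        (PairIn v1 v2 v7 ∧̇ PairIn v2 v0 v3)
        ⇒̇ ∃̇ (PairIn v0 v1 v6 ∧̇ PairIn v2 v0 v4))
           -- y' = v0, y = v1, x' = v2 ; B = v6, r = v4
  ∧̇ ∀̇ ∀̇ ∀̇ (   -- y = v2, y' = v1, x = v0 ; A = v7, B = v5, r = v3
        (PairIn v1 v2 v5 ∧̇ PairIn v0 v2 v3)
        ⇒̇ ∃̇ (PairIn v0 v1 (suc v7) ∧̇ PairIn v0 v2 v4)))
           -- x' = v0, x = v1, y' = v2 ; A = v8, r = v4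

-- (x ∈ y)†*  with g, h for x, y:  ∃z (⟨z, π₂ h⟩ ∈ π₁ h ∧ g ≈ ⟨π₁ h, z⟩),
-- where π₁ h = A, π₂ h = a for h = ⟨A,a⟩.
MemT : ∀ {n} → Fin n → Fin n → Fm n
MemT g h = ∃̇ ∃̇ (   -- A = v1, a = v0
  IsPair (↑ 2 h) v1 v0 ∧̇
  ∃̇ (   -- z = v0, A = v2, a = v1
    PairIn v0 v1 v2 ∧̇
    ∃̇ (IsPair v0 v3 v1 ∧̇ Bisim (↑ 4 g) v0)))   -- p = ⟨A,z⟩ = v0, z = v1, A = v3

dag : ∀ {n} → Fm n → Fm n
dag (x ≐ y)  = Bisim x y
dag (x ∈̇ y)  = MemT x y
dag ⊤̇        = ⊤̇
dag ⊥̇        = ⊥̇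
dag (A ∧̇ B)  = dag A ∧̇ dag B
dag (A ∨̇ B)  = dag A ∨̇ dag B
dag (A ⇒̇ B)  = dag A ⇒̇ dag B
dag (∀̇ Q)    = ∀̇ (Rgraph v0 ⇒̇ dag Q)
dag (∃̇ Q)    = ∃̇ (Rgraph v0 ∧̇ dag Q)

Prop14Formula : ∀ n → Fm n → Fm 0
Prop14Formula n P =
  closeAll (n + n)
    (⋀ (λ i → Reif (n ↑ʳ i) (i ↑ˡ n))
     ⇒̇ (ren (λ i → i ↑ˡ n) P ⇔̇ ren (λ i → n ↑ʳ i) (dag P)))

-- A pointed graph g reifying x determines x up to bisimilarity. If g = ⟨A,a⟩ and h = ⟨B,b⟩ reify x and y through
-- collapses φ and ψ, a bisimulation r between them makes {(φ̂(i), ψ̂(j)) | ⟨i,j⟩ ∈ r} a bisimulation for ∈, so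
-- x = y by strong extensionality; conversely, if x = y then {⟨i,j⟩ | φ̂(i) and ψ̂(j) have the same elements} is a
-- bisimulation relating a and b. Likewise x ∈ y iff g is bisimilar to ⟨B,z⟩ for a child z of b, since ⟨B,z⟩
-- reifies ψ(z). Every set x has a reification: the membership relation on a transitive set containing x,
-- collapsed by the identity. Induction on P then gives P ⇔ P†*, the quantifier cases passing between sets and
-- reifiable graphs by these facts.

module Submission where

open import Defs
open import Data.Nat using (ℕ; zero; suc; _+_)
open import Data.Fin using (Fin; zero; suc; _↑ˡ_; _↑ʳ_)
open import Data.List using (List; []; _∷_; map)
open import Data.List.Membership.Propositional.Properties using (∈-map⁺)
open import Data.List.Relation.Binary.Subset.Propositional using (_⊆_)
open import Data.List.Relation.Binary.Subset.Propositional.Properties using (map⁺; ∷⁺ʳ)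
open import Data.List.Relation.Unary.Any using (here; there)
open import Data.Vec.Functional using () renaming (_∷_ to _∷ᵥ_; [] to []ᵥ)
open import Relation.Binary.PropositionalEquality

Cx : ℕ → Set
Cx n = List (Fm n)

variable
  n : ℕ
  Γ : Cx n

ext-cong : ∀ {n m} {f g : Fin n → Fin m} → (∀ i → f i ≡ g i) → ∀ i → ext f i ≡ ext g i
ext-cong e zero    = refl
ext-cong e (suc i) = cong suc (e i)

ren-cong : ∀ {n m} {f g : Fin n → Fin m} → (∀ i → f i ≡ g i) → ∀ A → ren f A ≡ ren g A
ren-cong e (x ≐ y) = cong₂ _≐_ (e x) (e y)
ren-cong e (x ∈̇ y) = cong₂ _∈̇_ (e x) (e y)
ren-cong e ⊤̇       = refl
ren-cong e ⊥̇       = refl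
ren-cong e (A ∧̇ B) = cong₂ _∧̇_ (ren-cong e A) (ren-cong e B)
ren-cong e (A ∨̇ B) = cong₂ _∨̇_ (ren-cong e A) (ren-cong e B)
ren-cong e (A ⇒̇ B) = cong₂ _⇒̇_ (ren-cong e A) (ren-cong e B)
ren-cong e (∀̇ A)   = cong ∀̇_ (ren-cong (ext-cong e) A)
ren-cong e (∃̇ A)   = cong ∃̇_ (ren-cong (ext-cong e) A)

ext-fusion : ∀ {n m k} {f : Fin m → Fin k} {g : Fin n → Fin m} {h : Fin n → Fin k} →
             (∀ i → f (g i) ≡ h i) → ∀ i → ext f (ext g i) ≡ ext h i
ext-fusion e zero    = refl
ext-fusion e (suc i) = cong suc (e i)

ren-fusion : ∀ {n m k} {f : Fin m → Fin k} {g : Fin n → Fin m} {h : Fin n → Fin k} →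
             (∀ i → f (g i) ≡ h i) → ∀ A → ren f (ren g A) ≡ ren h A
ren-fusion e (x ≐ y) = cong₂ _≐_ (e x) (e y)
ren-fusion e (x ∈̇ y) = cong₂ _∈̇_ (e x) (e y)
ren-fusion e ⊤̇       = refl
ren-fusion e ⊥̇       = refl
ren-fusion e (A ∧̇ B) = cong₂ _∧̇_ (ren-fusion e A) (ren-fusion e B)
ren-fusion e (A ∨̇ B) = cong₂ _∨̇_ (ren-fusion e A) (ren-fusion e B)
ren-fusion e (A ⇒̇ B) = cong₂ _⇒̇_ (ren-fusion e A) (ren-fusion e B)
ren-fusion e (∀̇ A)   = cong ∀̇_ (ren-fusion (ext-fusion e) A)
ren-fusion e (∃̇ A)   = cong ∃̇_ (ren-fusion (ext-fusion e) A)

ren-id : ∀ {n} (A : Fm n) → ren (λ i → i) A ≡ A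
ren-id (x ≐ y) = refl
ren-id (x ∈̇ y) = refl
ren-id ⊤̇       = refl
ren-id ⊥̇       = refl
ren-id (A ∧̇ B) = cong₂ _∧̇_ (ren-id A) (ren-id B)
ren-id (A ∨̇ B) = cong₂ _∨̇_ (ren-id A) (ren-id B)
ren-id (A ⇒̇ B) = cong₂ _⇒̇_ (ren-id A) (ren-id B)
ren-id (∀̇ A)   = cong ∀̇_ (trans (ren-cong (λ { zero → refl ; (suc i) → refl }) A) (ren-id A))
ren-id (∃̇ A)   = cong ∃̇_ (trans (ren-cong (λ { zero → refl ; (suc i) → refl }) A) (ren-id A))

ren-wk : ∀ {n m} (ρ : Fin n → Fin m) A → ren (ext ρ) (wk A) ≡ wk (ren ρ A)
ren-wk ρ A = trans (ren-fusion (λ _ → refl) A) (sym (ren-fusion (λ _ → refl) A))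

map-ren-wk : ∀ {n m} (ρ : Fin n → Fin m) (Γ : Cx n) →
             map (ren (ext ρ)) (map wk Γ) ≡ map wk (map (ren ρ) Γ)
map-ren-wk ρ []      = refl
map-ren-wk ρ (A ∷ Γ) = cong₂ _∷_ (ren-wk ρ A) (map-ren-wk ρ Γ)

ren-inst : ∀ {n m} (ρ : Fin n → Fin m) (A : Fm (suc n)) x →
           ren ρ (inst A x) ≡ inst (ren (ext ρ) A) (ρ x)
ren-inst ρ A x = trans (ren-fusion (λ _ → refl) A)
                       (sym (ren-fusion (λ { zero → refl ; (suc i) → refl }) A))

ren-fromClosed : ∀ {n m} (ρ : Fin n → Fin m) (A : Fm 0) → ren ρ (fromClosed A) ≡ fromClosed A
ren-fromClosed ρ A = ren-fusion (λ ()) A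

inst-fresh : ∀ {n} (A : Fm (suc n)) → inst (ren (ext suc) A) zero ≡ A
inst-fresh A = trans (ren-fusion (λ { zero → refl ; (suc i) → refl }) A) (ren-id A)

weaken : ∀ {n} {Γ Δ : Cx n} {A} → Γ ⊆ Δ → Γ ⊢ A → Δ ⊢ A
weaken s (hyp x)      = hyp (s x)
weaken s (ax x)       = ax x
weaken s ⊤I           = ⊤I
weaken s (⊥E d)       = ⊥E (weaken s d)
weaken s (∧I d e)     = ∧I (weaken s d) (weaken s e)
weaken s (∧E₁ d)      = ∧E₁ (weaken s d)
weaken s (∧E₂ d)      = ∧E₂ (weaken s d)
weaken s (∨I₁ d)      = ∨I₁ (weaken s d)
weaken s (∨I₂ d)      = ∨I₂ (weaken s d)
weaken s (∨E d e f)   = ∨E (weaken s d) (weaken (∷⁺ʳ _ s) e) (weaken (∷⁺ʳ _ s) f)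
weaken s (⇒I d)       = ⇒I (weaken (∷⁺ʳ _ s) d)
weaken s (⇒E d e)     = ⇒E (weaken s d) (weaken s e)
weaken s (∀I d)       = ∀I (weaken (map⁺ wk s) d)
weaken s (∀E d x)     = ∀E (weaken s d) x
weaken s (∃I x d)     = ∃I x (weaken s d)
weaken s (∃E d e)     = ∃E (weaken s d) (weaken (∷⁺ʳ _ (map⁺ wk s)) e)

rename : ∀ {n m} (ρ : Fin n → Fin m) {Γ : Cx n} {A} → Γ ⊢ A → map (ren ρ) Γ ⊢ ren ρ A
rename ρ (hyp x)              = hyp (∈-map⁺ (ren ρ) x)
rename ρ (ax {A = A} x)       = subst (_ ⊢_) (sym (ren-fromClosed ρ A)) (ax x)
rename ρ ⊤I                   = ⊤I
rename ρ (⊥E d)               = ⊥E (rename ρ d)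
rename ρ (∧I d e)             = ∧I (rename ρ d) (rename ρ e)
rename ρ (∧E₁ d)              = ∧E₁ (rename ρ d)
rename ρ (∧E₂ d)              = ∧E₂ (rename ρ d)
rename ρ (∨I₁ d)              = ∨I₁ (rename ρ d)
rename ρ (∨I₂ d)              = ∨I₂ (rename ρ d)
rename ρ (∨E d e f)           = ∨E (rename ρ d) (rename ρ e) (rename ρ f)
rename ρ (⇒I d)               = ⇒I (rename ρ d)
rename ρ (⇒E d e)             = ⇒E (rename ρ d) (rename ρ e)
rename ρ {Γ} (∀I d)           = ∀I (subst (_⊢ _) (map-ren-wk ρ Γ) (rename (ext ρ) d))
rename ρ (∀E {A = A} d x)     = subst (_ ⊢_) (sym (ren-inst ρ A x)) (∀E (rename ρ d) (ρ x))
rename ρ (∃I {A = A} x d)     = ∃I (ρ x) (subst (_ ⊢_) (ren-inst ρ A x) (rename ρ d))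
rename ρ {Γ} (∃E {A = A} {C = C} d e) =
  ∃E (rename ρ d) (subst₂ (λ Δ B → (ren (ext ρ) A ∷ Δ) ⊢ B) (map-ren-wk ρ Γ) (ren-wk ρ C) (rename (ext ρ) e))

shift : ∀ {B} → Γ ⊢ B → map wk Γ ⊢ wk B
shift = rename suc

weaken₁ : ∀ {A B} → Γ ⊢ B → (A ∷ Γ) ⊢ B
weaken₁ = weaken there

shift∃ : ∀ {A B} → Γ ⊢ B → (A ∷ map wk Γ) ⊢ wk B
shift∃ d = weaken₁ (shift d)

hyp₀ : ∀ {A} → (A ∷ Γ) ⊢ A
hyp₀ = hyp (here refl)

cast : ∀ {A B} → A ≡ B → Γ ⊢ A → Γ ⊢ B
cast refl d = d

⇔I : ∀ {A B} → (A ∷ Γ) ⊢ B → (B ∷ Γ) ⊢ A → Γ ⊢ A ⇔̇ B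
⇔I d e = ∧I (⇒I d) (⇒I e)

⇔E₁ : ∀ {A B} → Γ ⊢ A ⇔̇ B → Γ ⊢ A → Γ ⊢ B
⇔E₁ d e = ⇒E (∧E₁ d) e

⇔E₂ : ∀ {A B} → Γ ⊢ A ⇔̇ B → Γ ⊢ B → Γ ⊢ A
⇔E₂ d e = ⇒E (∧E₂ d) e

⇔-sym : ∀ {A B} → Γ ⊢ A ⇔̇ B → Γ ⊢ B ⇔̇ A
⇔-sym d = ∧I (∧E₂ d) (∧E₁ d)

⇔-trans : ∀ {A B C} → Γ ⊢ A ⇔̇ B → Γ ⊢ B ⇔̇ C → Γ ⊢ A ⇔̇ C
⇔-trans d e = ⇔I (⇔E₁ (weaken₁ e) (⇔E₁ (weaken₁ d) hyp₀)) (⇔E₂ (weaken₁ d) (⇔E₂ (weaken₁ e) hyp₀))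

Transport : ∀ {m} → (Fin n → Fin m) → Cx n → Cx m → Set
Transport ρ Γ Δ = ∀ {B} → Γ ⊢ B → Δ ⊢ ren ρ B

_⊙_ : ∀ {m k} {σ : Fin m → Fin k} {ρ : Fin n → Fin m} {Δ : Cx m} {Θ : Cx k} →
      Transport σ Δ Θ → Transport ρ Γ Δ → Transport (λ i → σ (ρ i)) Γ Θ
(t ⊙ s) {B} d = cast (ren-fusion (λ _ → refl) B) (t (s d))

weaken₁ᵗ : ∀ {m} {ρ : Fin n → Fin m} {Δ : Cx m} {A} → Transport ρ Γ Δ → Transport ρ Γ (A ∷ Δ)
weaken₁ᵗ t d = weaken₁ (t d)

shift∀³⇒ : ∀ {A} → Transport (↑ 3) Γ (A ∷ map wk (map wk (map wk Γ)))
shift∀³⇒ = shift∃ ⊙ (shift ⊙ shift)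

obtain : ∀ {A C} → Γ ⊢ ∃̇ A → (∀ {Δ} → Transport suc Γ Δ → Δ ⊢ A → Δ ⊢ wk C) → Γ ⊢ C
obtain d k = ∃E d (k shift∃ hyp₀)

-- ren ρ (F x …) computes to F (ρ x) … for the predicates F of Defs, but Agda cannot recover B from such a
-- reduct; the large F therefore get transports that supply B themselves.
module _ {m} {ρ : Fin n → Fin m} {Γ : Cx n} {Δ : Cx m} (t : Transport ρ Γ Δ) where

  ⇑Collapse : ∀ {A φ} → Γ ⊢ Collapse A φ → Δ ⊢ Collapse (ρ A) (ρ φ)
  ⇑Collapse {A} {φ} d = t {Collapse A φ} d

  ⇑EqHat : ∀ {x φ A a} → Γ ⊢ EqHat x φ A a → Δ ⊢ EqHat (ρ x) (ρ φ) (ρ A) (ρ a)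
  ⇑EqHat {x} {φ} {A} {a} d = t {EqHat x φ A a} d

  ⇑Reif : ∀ {g x} → Γ ⊢ Reif g x → Δ ⊢ Reif (ρ g) (ρ x)
  ⇑Reif {g} {x} d = t {Reif g x} d

  ⇑Bisim : ∀ {g h} → Γ ⊢ Bisim g h → Δ ⊢ Bisim (ρ g) (ρ h)
  ⇑Bisim {g} {h} d = t {Bisim g h} d

  ⇑MemT : ∀ {g h} → Γ ⊢ MemT g h → Δ ⊢ MemT (ρ g) (ρ h)
  ⇑MemT {g} {h} d = t {MemT g h} d

closeAll-inst : ∀ k (A : Fm k) (ρ : Fin k → Fin n) → Γ ⊢ fromClosed (closeAll k A) → Γ ⊢ ren ρ A
closeAll-inst zero    A ρ d = cast (ren-cong (λ ()) A) d
closeAll-inst (suc k) A ρ d =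
  cast (ren-fusion (λ { zero → refl ; (suc i) → refl }) A) (∀E (closeAll-inst k (∀̇ A) (λ i → ρ (suc i)) d) (ρ zero))

strong-ext-inst : ∀ k (R : Fm (suc (suc k))) (ρ : Fin k → Fin n) → Γ ⊢ ren ρ (StrongExt k R)
strong-ext-inst k R ρ = closeAll-inst k (StrongExt k R) ρ (ax (strong-ext k R))

compr-inst : ∀ k (P : Fm (suc k)) (ρ : Fin k → Fin n) → Γ ⊢ ren ρ (Compr k P)
compr-inst k P ρ = closeAll-inst k (Compr k P) ρ (ax (compr k P))

module _ {Γ : Cx n} where

  ≐-refl : ∀ x → Γ ⊢ x ≐ x
  ≐-refl x = ∀E (ax eq-refl) x

  ≐-eucl : ∀ {x x′ y} → Γ ⊢ x ≐ x′ → Γ ⊢ x ≐ y → Γ ⊢ x′ ≐ y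
  ≐-eucl {x} {x′} {y} d e = ⇒E (∀E (∀E (∀E (ax eq-eucl) x) x′) y) (∧I d e)

  ≐-sym : ∀ {x y} → Γ ⊢ x ≐ y → Γ ⊢ y ≐ x
  ≐-sym {x} d = ≐-eucl d (≐-refl x)

  ≐-trans : ∀ {x y z} → Γ ⊢ x ≐ y → Γ ⊢ y ≐ z → Γ ⊢ x ≐ z
  ≐-trans d e = ≐-eucl (≐-sym d) e

  ∈-substˡ : ∀ {x x′ y} → Γ ⊢ x ≐ x′ → Γ ⊢ x ∈̇ y → Γ ⊢ x′ ∈̇ y
  ∈-substˡ {x} {x′} {y} d e = ⇒E (∀E (∀E (∀E (ax eq-∈ˡ) x) x′) y) (∧I d e)

  ∈-substʳ : ∀ {x y y′} → Γ ⊢ y ≐ y′ → Γ ⊢ x ∈̇ y → Γ ⊢ x ∈̇ y′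
  ∈-substʳ {x} {y} {y′} d e = ⇒E (∀E (∀E (∀E (ax eq-∈ʳ) x) y) y′) (∧I d e)

  ∈-subst₂ : ∀ {x x′ y y′} → Γ ⊢ x ≐ x′ → Γ ⊢ y ≐ y′ → Γ ⊢ x ∈̇ y → Γ ⊢ x′ ∈̇ y′
  ∈-subst₂ d e f = ∈-substʳ e (∈-substˡ d f)

ext-resp-≐ : ∀ {k} {Δ : Cx (suc n)} {f g : Fin k → Fin n} → Transport suc Γ Δ →
             (∀ i → Γ ⊢ f i ≐ g i) → ∀ i → Δ ⊢ ext f i ≐ ext g i
ext-resp-≐ t e zero    = ≐-refl zero
ext-resp-≐ t e (suc i) = t (e i)

ren-resp-≐ : ∀ {k} (B : Fm k) {f g : Fin k → Fin n} →
             (∀ i → Γ ⊢ f i ≐ g i) → Γ ⊢ ren f B → Γ ⊢ ren g B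
ren-resp-≐ (x ≐ y) e d = ≐-trans (≐-sym (e x)) (≐-trans d (e y))
ren-resp-≐ (x ∈̇ y) e d = ∈-subst₂ (e x) (e y) d
ren-resp-≐ ⊤̇       e d = ⊤I
ren-resp-≐ ⊥̇       e d = d
ren-resp-≐ (A ∧̇ B) e d = ∧I (ren-resp-≐ A e (∧E₁ d)) (ren-resp-≐ B e (∧E₂ d))
ren-resp-≐ (A ∨̇ B) e d =
  ∨E d (∨I₁ (ren-resp-≐ A (λ i → weaken₁ (e i)) hyp₀)) (∨I₂ (ren-resp-≐ B (λ i → weaken₁ (e i)) hyp₀))
ren-resp-≐ (A ⇒̇ B) e d =
  ⇒I (ren-resp-≐ B (λ i → weaken₁ (e i)) (⇒E (weaken₁ d) (ren-resp-≐ A (λ i → ≐-sym (weaken₁ (e i))) hyp₀)))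
ren-resp-≐ (∀̇ A) {f} e d =
  ∀I (ren-resp-≐ A (ext-resp-≐ shift e) (cast (inst-fresh (ren (ext f) A)) (∀E (shift d) zero)))
ren-resp-≐ (∃̇ A) {g = g} e d =
  ∃E d (∃I zero (cast (sym (inst-fresh (ren (ext g) A))) (ren-resp-≐ A (ext-resp-≐ shift∃ e) hyp₀)))

≐-subst : ∀ (A : Fm (suc n)) {x y} → Γ ⊢ x ≐ y → Γ ⊢ inst A x → Γ ⊢ inst A y
≐-subst A e = ren-resp-≐ A λ { zero → e ; (suc i) → ≐-refl i }

Coextensive : Fin n → Fin n → Fm n
Coextensive u w = ∀̇ (v0 ∈̇ suc u ⇔̇ v0 ∈̇ suc w)

coextensive-refl : ∀ (u : Fin n) → Γ ⊢ Coextensive u u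
coextensive-refl u = ∀I (⇔I hyp₀ hyp₀)

-- Strong extensionality for "same elements", a bisimulation in which x′ ∈ x is matched by x′ itself.
extensionality : ∀ {a b : Fin n} → Γ ⊢ Coextensive a b → Γ ⊢ a ≐ b
extensionality {a = a} {b} d =
  ⇒E (∀E (∀E (strong-ext-inst 0 (Coextensive v0 v1) (λ ())) a) b)
     (∧I d (∧I (∀I (∀I (∀I (⇒I (∃I v1 (∧I (⇔E₁ (∀E (∧E₂ hyp₀) v1) (∧E₁ hyp₀)) (coextensive-refl v1)))))))
               (∀I (∀I (∀I (⇒I (∃I v1 (∧I (⇔E₂ (∀E (∧E₂ hyp₀) v1) (∧E₁ hyp₀)) (coextensive-refl v1)))))))))

members-unique : ∀ {w s : Fin n} (F : Fm (suc n)) →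
                 Γ ⊢ ∀̇ (v0 ∈̇ suc w ⇔̇ F) → Γ ⊢ ∀̇ (v0 ∈̇ suc s ⇔̇ F) → Γ ⊢ w ≐ s
members-unique {w = w} {s} F d e =
  extensionality (∀I (⇔-trans (cast (inst-fresh (v0 ∈̇ suc w ⇔̇ F)) (∀E (shift d) zero))
                              (⇔-sym (cast (inst-fresh (v0 ∈̇ suc s ⇔̇ F)) (∀E (shift e) zero)))))

singleton-exists : ∀ (a : Fin n) → Γ ⊢ ∃̇ IsSing v0 (suc a)
singleton-exists a = ∃E (∀E (∀E (ax pairing) a) a)
  (∃I zero (∀I (⇔I (∨E (⇔E₁ (∀E (shift∃ hyp₀) zero) hyp₀) hyp₀ hyp₀) (⇔E₂ (∀E (shift∃ hyp₀) zero) (∨I₁ hyp₀)))))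

doubleton-exists : ∀ (a b : Fin n) → Γ ⊢ ∃̇ IsDoub v0 (suc a) (suc b)
doubleton-exists a b = ∀E (∀E (ax pairing) a) b

IsSing-iff-≐ : ∀ {s w a : Fin n} → Γ ⊢ IsSing s a → Γ ⊢ IsSing w a ⇔̇ w ≐ s
IsSing-iff-≐ {a = a} d =
  ⇔I (members-unique (v0 ≐ suc a) hyp₀ (weaken₁ d)) (≐-subst (IsSing v0 (suc a)) (≐-sym hyp₀) (weaken₁ d))

IsDoub-iff-≐ : ∀ {s w a b : Fin n} → Γ ⊢ IsDoub s a b → Γ ⊢ IsDoub w a b ⇔̇ w ≐ s
IsDoub-iff-≐ {a = a} {b} d =
  ⇔I (members-unique (v0 ≐ suc a ∨̇ v0 ≐ suc b) hyp₀ (weaken₁ d))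
     (≐-subst (IsDoub v0 (suc a) (suc b)) (≐-sym hyp₀) (weaken₁ d))

pair-exists : ∀ (a b : Fin n) → Γ ⊢ ∃̇ IsPair v0 (suc a) (suc b)
pair-exists a b =
  obtain (singleton-exists a) λ t₁ S → obtain (doubleton-exists (suc a) (suc b)) λ t₂ D →
  obtain (doubleton-exists v1 v0) λ t₃ P →
  let S′ = shift ((t₃ ⊙ t₂) S)
      D′ = shift (t₃ D)
  in ∃I zero (∀I (⇔-trans (∀E (shift P) zero) (⇔I
       (∨E hyp₀ (∨I₁ (⇔E₂ (IsSing-iff-≐ (weaken₁ (weaken₁ S′))) hyp₀))
                (∨I₂ (⇔E₂ (IsDoub-iff-≐ (weaken₁ (weaken₁ D′))) hyp₀)))
       (∨E hyp₀ (∨I₁ (⇔E₁ (IsSing-iff-≐ (weaken₁ (weaken₁ S′))) hyp₀))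
                (∨I₂ (⇔E₁ (IsDoub-iff-≐ (weaken₁ (weaken₁ D′))) hyp₀))))))

module _ {Γ : Cx n} where

  sing-∈ : ∀ {s a} → Γ ⊢ IsSing s a → Γ ⊢ a ∈̇ s
  sing-∈ {a = a} d = ⇔E₂ (∀E d a) (≐-refl a)

  sing-≐ : ∀ {s a x} → Γ ⊢ IsSing s a → Γ ⊢ x ∈̇ s → Γ ⊢ x ≐ a
  sing-≐ {x = x} d m = ⇔E₁ (∀E d x) m

  doub-∈₁ : ∀ {s a b} → Γ ⊢ IsDoub s a b → Γ ⊢ a ∈̇ s
  doub-∈₁ {a = a} d = ⇔E₂ (∀E d a) (∨I₁ (≐-refl a))

  doub-∈₂ : ∀ {s a b} → Γ ⊢ IsDoub s a b → Γ ⊢ b ∈̇ s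
  doub-∈₂ {b = b} d = ⇔E₂ (∀E d b) (∨I₂ (≐-refl b))

  doub-≐ : ∀ {s a b x} → Γ ⊢ IsDoub s a b → Γ ⊢ x ∈̇ s → Γ ⊢ x ≐ a ∨̇ x ≐ b
  doub-≐ {x = x} d m = ⇔E₁ (∀E d x) m

  pair-∋-sing : ∀ {p a b s} → Γ ⊢ IsPair p a b → Γ ⊢ IsSing s a → Γ ⊢ s ∈̇ p
  pair-∋-sing {s = s} d e = ⇔E₂ (∀E d s) (∨I₁ e)

  pair-∋-doub : ∀ {p a b s} → Γ ⊢ IsPair p a b → Γ ⊢ IsDoub s a b → Γ ⊢ s ∈̇ p
  pair-∋-doub {s = s} d e = ⇔E₂ (∀E d s) (∨I₂ e)

  pair-∈ : ∀ {p a b s} → Γ ⊢ IsPair p a b → Γ ⊢ s ∈̇ p → Γ ⊢ IsSing s a ∨̇ IsDoub s a b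
  pair-∈ {s = s} d m = ⇔E₁ (∀E d s) m

pair-inj₁ : ∀ {p a b c d : Fin n} → Γ ⊢ IsPair p a b → Γ ⊢ IsPair p c d → Γ ⊢ a ≐ c
pair-inj₁ {a = a} P Q = obtain (singleton-exists a) λ t S →
  ∨E (pair-∈ (t Q) (pair-∋-sing (t P) S))
     (sing-≐ hyp₀ (weaken₁ (sing-∈ S)))
     (≐-sym (sing-≐ (weaken₁ S) (doub-∈₁ hyp₀)))

pair-inj₂-diagonal : ∀ {p a b c d : Fin n} → Γ ⊢ IsPair p a b → Γ ⊢ IsPair p c d →
                     Γ ⊢ a ≐ c → Γ ⊢ b ≐ c → Γ ⊢ d ≐ b
pair-inj₂-diagonal {c = c} {d} P Q a≐c b≐c = obtain (doubleton-exists c d) λ t D →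
  let d∈D = doub-∈₂ D
      d≐a⇒d≐b = ⇒I (≐-trans hyp₀ (≐-trans (weaken₁ (t a≐c)) (≐-sym (weaken₁ (t b≐c)))))
  in ∨E (pair-∈ (t P) (pair-∋-doub (t Q) D))
        (⇒E (weaken₁ d≐a⇒d≐b) (sing-≐ hyp₀ (weaken₁ d∈D)))
        (∨E (doub-≐ hyp₀ (weaken₁ d∈D)) (⇒E (weaken₁ (weaken₁ d≐a⇒d≐b)) hyp₀) hyp₀)

pair-inj₂ : ∀ {p a b c d : Fin n} → Γ ⊢ IsPair p a b → Γ ⊢ IsPair p c d → Γ ⊢ b ≐ d
pair-inj₂ {a = a} {b} P Q = obtain (doubleton-exists a b) λ t D →
  let b∈D = doub-∈₂ D
      b≐c⇒b≐d = ⇒I (≐-sym (pair-inj₂-diagonal (weaken₁ (t P)) (weaken₁ (t Q)) (weaken₁ (t (pair-inj₁ P Q))) hyp₀))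
  in ∨E (pair-∈ (t Q) (pair-∋-doub (t P) D))
        (⇒E (weaken₁ b≐c⇒b≐d) (sing-≐ hyp₀ (weaken₁ b∈D)))
        (∨E (doub-≐ hyp₀ (weaken₁ b∈D)) (⇒E (weaken₁ (weaken₁ b≐c⇒b≐d)) hyp₀) hyp₀)

infix 7 _⊆̇_ _²⊆̇_ ⋃⋃_⊆̇_

_⊆̇_ : Fin n → Fin n → Fm n
X ⊆̇ Y = ∀̇ (v0 ∈̇ suc X ⇒̇ v0 ∈̇ suc Y)

IsPowerset : Fin n → Fin n → Fm n
IsPowerset P A = ∀̇ (v0 ∈̇ suc P ⇔̇ v0 ⊆̇ suc A)

-- z ∈ ⋃⋃A, in the form of the first conjunct of InCar.
In⋃⋃ : Fin n → Fin n → Fm n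
In⋃⋃ z A = ∃̇ ∃̇ (v1 ∈̇ ↑ 2 A ∧̇ v0 ∈̇ v1 ∧̇ ↑ 2 z ∈̇ v0)

⋃⋃_⊆̇_ : Fin n → Fin n → Fm n
⋃⋃ A ⊆̇ G = ∀̇ (In⋃⋃ v0 (suc A) ⇒̇ v0 ∈̇ suc G)

_²⊆̇_ : Fin n → Fin n → Fm n
U ²⊆̇ S = ∀̇ ∀̇ ∀̇ ((v2 ∈̇ ↑ 3 U ∧̇ v1 ∈̇ ↑ 3 U ∧̇ IsPair v0 v2 v1) ⇒̇ v0 ∈̇ ↑ 3 S)

module _ {Γ : Cx n} where

  ⊆̇-intro : ∀ {X Y} → (∀ {Δ} → Transport suc Γ Δ → Δ ⊢ v0 ∈̇ suc X → Δ ⊢ v0 ∈̇ suc Y) → Γ ⊢ X ⊆̇ Y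
  ⊆̇-intro k = ∀I (⇒I (k shift∃ hyp₀))

  ⊆̇-elim : ∀ {X Y z} → Γ ⊢ X ⊆̇ Y → Γ ⊢ z ∈̇ X → Γ ⊢ z ∈̇ Y
  ⊆̇-elim {z = z} s m = ⇒E (∀E s z) m

  ⋃⋃⊆̇-elim : ∀ {A G z} → Γ ⊢ ⋃⋃ A ⊆̇ G → Γ ⊢ In⋃⋃ z A → Γ ⊢ z ∈̇ G
  ⋃⋃⊆̇-elim {z = z} s m = ⇒E (∀E s z) m

  ²⊆̇-elim : ∀ {U S i j p} → Γ ⊢ U ²⊆̇ S → Γ ⊢ i ∈̇ U → Γ ⊢ j ∈̇ U → Γ ⊢ IsPair p i j → Γ ⊢ p ∈̇ S
  ²⊆̇-elim {i = i} {j} {p} s i∈U j∈U P = ⇒E (∀E (∀E (∀E s i) j) p) (∧I i∈U (∧I j∈U P))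

  powerset-∋ : ∀ {P A z} → Γ ⊢ IsPowerset P A → Γ ⊢ z ⊆̇ A → Γ ⊢ z ∈̇ P
  powerset-∋ {z = z} d s = ⇔E₂ (∀E d z) s

  pair-⊆ : ∀ {U x y p w z} → Γ ⊢ x ∈̇ U → Γ ⊢ y ∈̇ U → Γ ⊢ IsPair p x y → Γ ⊢ w ∈̇ p → Γ ⊢ z ∈̇ w → Γ ⊢ z ∈̇ U
  pair-⊆ x∈U y∈U P w∈p z∈w = ∨E (pair-∈ P w∈p)
    (∈-substˡ (≐-sym (sing-≐ hyp₀ (weaken₁ z∈w))) (weaken₁ x∈U))
    (∨E (doub-≐ hyp₀ (weaken₁ z∈w)) (∈-substˡ (≐-sym hyp₀) (weaken₁ (weaken₁ x∈U)))
                                     (∈-substˡ (≐-sym hyp₀) (weaken₁ (weaken₁ y∈U))))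

⊆̇-trans : ∀ {X Y Z : Fin n} → Γ ⊢ X ⊆̇ Y → Γ ⊢ Y ⊆̇ Z → Γ ⊢ X ⊆̇ Z
⊆̇-trans s s′ = ⊆̇-intro λ t m → ⊆̇-elim (t s′) (⊆̇-elim (t s) m)

⋃⋃⊆̇-trans : ∀ {A X Y : Fin n} → Γ ⊢ ⋃⋃ A ⊆̇ X → Γ ⊢ X ⊆̇ Y → Γ ⊢ ⋃⋃ A ⊆̇ Y
⋃⋃⊆̇-trans s s′ = ∀I (⇒I (⊆̇-elim (shift∃ s′) (⋃⋃⊆̇-elim (shift∃ s) hyp₀)))

powerset-exists : ∀ (A : Fin n) → Γ ⊢ ∃̇ IsPowerset v0 (suc A)
powerset-exists A = ∀E (ax powerset) A

square-superset-exists : ∀ (U : Fin n) → Γ ⊢ ∃̇ (suc U ²⊆̇ v0)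
square-superset-exists U =
  obtain (powerset-exists U) λ t P → obtain (powerset-exists v0) λ t′ S →
  ∃I zero (∀I (∀I (∀I (⇒I
    (powerset-∋ (weaken₁ (shift (shift (shift S)))) (⊆̇-intro λ s w∈p →
      powerset-∋ (s (weaken₁ (shift (shift (shift (t′ P)))))) (⊆̇-intro λ s′ z∈w →
        pair-⊆ (s′ (s (∧E₁ hyp₀))) (s′ (s (∧E₁ (∧E₂ hyp₀)))) (s′ (s (∧E₂ (∧E₂ hyp₀)))) (s′ w∈p) z∈w)))))))

IsUnion : Fin n → Fin n → Fm n
IsUnion V A = ∀̇ (v0 ∈̇ suc V ⇔̇ ∃̇ (v0 ∈̇ ↑ 2 A ∧̇ v1 ∈̇ v0))

union-exists : ∀ (A : Fin n) → Γ ⊢ ∃̇ IsUnion v0 (suc A)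
union-exists A = ∀E (ax union) A

union-∋ : ∀ {V A w z : Fin n} → Γ ⊢ IsUnion V A → Γ ⊢ w ∈̇ A → Γ ⊢ z ∈̇ w → Γ ⊢ z ∈̇ V
union-∋ {w = w} {z} d w∈A z∈w = ⇔E₂ (∀E d z) (∃I w (∧I w∈A z∈w))

upper-bound-exists : ∀ (X Y : Fin n) → Γ ⊢ ∃̇ (suc X ⊆̇ v0 ∧̇ suc Y ⊆̇ v0)
upper-bound-exists X Y =
  obtain (doubleton-exists X Y) λ t D → obtain (union-exists v0) λ t′ V →
  ∃I zero (∧I (⊆̇-intro λ s z∈X → union-∋ (s V) (s (t′ (doub-∈₁ D))) z∈X)
              (⊆̇-intro λ s z∈Y → union-∋ (s V) (s (t′ (doub-∈₂ D))) z∈Y))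

⋃⋃-bound-exists : ∀ (A : Fin n) → Γ ⊢ ∃̇ (⋃⋃ suc A ⊆̇ v0)
⋃⋃-bound-exists A =
  obtain (union-exists A) λ t V₁ → obtain (union-exists v0) λ t′ V₂ →
  ∃I zero (∀I (⇒I (obtain hyp₀ λ s H → obtain H λ s′ H′ →
    union-∋ (s′ (s (weaken₁ (shift V₂))))
            (union-∋ (s′ (s (weaken₁ (shift (t′ V₁))))) (∧E₁ H′) (∧E₁ (∧E₂ H′)))
            (∧E₂ (∧E₂ H′)))))

bound-exists : ∀ (A B a b : Fin n) → Γ ⊢ ∃̇ (⋃⋃ suc A ⊆̇ v0 ∧̇ ⋃⋃ suc B ⊆̇ v0 ∧̇ suc a ∈̇ v0 ∧̇ suc b ∈̇ v0)
bound-exists A B a b =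
  obtain (⋃⋃-bound-exists A) λ t₁ G₁ → obtain (⋃⋃-bound-exists (suc B)) λ t₂ G₂ →
  obtain (upper-bound-exists v1 v0) λ t₃ G → obtain (doubleton-exists (↑ 3 a) (↑ 3 b)) λ t₄ D →
  obtain (upper-bound-exists v1 v0) λ t₅ U →
  let G⊆U = ∧E₁ U
      D⊆U = ∧E₂ U
  in ∃I zero (∧I (⋃⋃⊆̇-trans ((t₅ ⊙ (t₄ ⊙ (t₃ ⊙ t₂))) G₁) (⊆̇-trans ((t₅ ⊙ t₄) (∧E₁ G)) G⊆U))
             (∧I (⋃⋃⊆̇-trans ((t₅ ⊙ (t₄ ⊙ t₃)) G₂) (⊆̇-trans ((t₅ ⊙ t₄) (∧E₂ G)) G⊆U))
             (∧I (⊆̇-elim D⊆U (t₅ (doub-∈₁ D))) (⊆̇-elim D⊆U (t₅ (doub-∈₂ D))))))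

InHat : Fin n → Fin n → Fin n → Fin n → Fm n
InHat y φ A k = InCod y φ ∧̇ ∃̇ (PairIn v0 (suc k) (suc A) ∧̇ PairIn v0 (suc y) (suc φ))

module _ {Γ : Cx n} where

  pairIn-intro : ∀ {p a b A} → Γ ⊢ IsPair p a b → Γ ⊢ p ∈̇ A → Γ ⊢ PairIn a b A
  pairIn-intro {p = p} d e = ∃I p (∧I d e)

  pairIn-subst₂ : ∀ {A j y y′} → Γ ⊢ y ≐ y′ → Γ ⊢ PairIn j y A → Γ ⊢ PairIn j y′ A
  pairIn-subst₂ {A} {j} e d = ≐-subst (PairIn (suc j) v0 (suc A)) e d

  pairIn-subst₃ : ∀ {a b A A′} → Γ ⊢ A ≐ A′ → Γ ⊢ PairIn a b A → Γ ⊢ PairIn a b A′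
  pairIn-subst₃ {a} {b} e d = ≐-subst (PairIn (suc a) (suc b) v0) e d

  dom-intro : ∀ {φ k w} → Γ ⊢ PairIn k w φ → Γ ⊢ InDom k φ
  dom-intro {w = w} P = ∃I w P

  app-intro : ∀ {φ k w y} → Γ ⊢ PairIn k w φ → Γ ⊢ y ∈̇ w → Γ ⊢ InApp y φ k
  app-intro {w = w} P m = ∃I w (∧I P m)

  eqApp-intro : ∀ {φ j y} → Γ ⊢ PairIn j y φ → Γ ⊢ EqApp y φ j
  eqApp-intro {y = y} P = ∃I y (∧I P (≐-refl y))

  hat-intro : ∀ {φ A j k y} → Γ ⊢ PairIn j k A → Γ ⊢ PairIn j y φ → Γ ⊢ InHat y φ A k
  hat-intro {j = j} jk jy = ∧I (∃I j jy) (∃I j (∧I jk jy))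

  eqHat-∋ : ∀ {x φ A i y k} → Γ ⊢ EqHat x φ A i → Γ ⊢ PairIn k i A → Γ ⊢ PairIn k y φ → Γ ⊢ y ∈̇ x
  eqHat-∋ {y = y} E ki ky = ⇔E₂ (∀E E y) (hat-intro ki ky)

  eqHat-∈ : ∀ {x φ A i y} → Γ ⊢ EqHat x φ A i → Γ ⊢ y ∈̇ x →
            Γ ⊢ ∃̇ (PairIn v0 (suc i) (suc A) ∧̇ PairIn v0 (suc y) (suc φ))
  eqHat-∈ {y = y} E m = ∧E₂ (⇔E₁ (∀E E y) m)

  func-unique : ∀ {φ i y y′} → Γ ⊢ Func φ → Γ ⊢ PairIn i y φ → Γ ⊢ PairIn i y′ φ → Γ ⊢ y ≐ y′
  func-unique {i = i} {y} {y′} F d e = ⇒E (∀E (∀E (∀E (∧E₂ F) i) y) y′) (∧I d e)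

pairIn-⋃⋃₁ : ∀ {j i A : Fin n} → Γ ⊢ PairIn j i A → Γ ⊢ In⋃⋃ j A
pairIn-⋃⋃₁ {j = j} d = obtain d λ t H → obtain (singleton-exists (suc j)) λ t′ S →
  ∃I v1 (∃I zero (∧I (t′ (∧E₂ H)) (∧I (pair-∋-sing (t′ (∧E₁ H)) S) (sing-∈ S))))

pairIn-⋃⋃₂ : ∀ {j i A : Fin n} → Γ ⊢ PairIn j i A → Γ ⊢ In⋃⋃ i A
pairIn-⋃⋃₂ {j = j} {i} d = obtain d λ t H → obtain (doubleton-exists (suc j) (suc i)) λ t′ D →
  ∃I v1 (∃I zero (∧I (t′ (∧E₂ H)) (∧I (pair-∋-doub (t′ (∧E₁ H)) D) (doub-∈₂ D))))

car-fst : ∀ {j i A : Fin n} → Γ ⊢ PairIn j i A → Γ ⊢ InCar j A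
car-fst {i = i} d = ∧I (pairIn-⋃⋃₁ d) (∃I i (∨I₁ d))

car-snd : ∀ {j i A : Fin n} → Γ ⊢ PairIn j i A → Γ ⊢ InCar i A
car-snd {j = j} d = ∧I (pairIn-⋃⋃₂ d) (∃I j (∨I₂ d))

module _ {Γ : Cx n} {A φ : Fin n} (C : Γ ⊢ Collapse A φ) where

  collapse-func : Γ ⊢ Func φ
  collapse-func = ∧E₁ (∧E₂ C)

  collapse-dom : ∀ {j} → Γ ⊢ InCar j A → Γ ⊢ InDom j φ
  collapse-dom {j} d = ⇔E₂ (∀E (∧E₁ (∧E₂ (∧E₂ C))) j) d

  collapse-at : ∀ {k x} → Γ ⊢ InDom k φ →
                Γ ⊢ InApp x φ k ⇔̇ ∃̇ (InDom v0 (suc φ) ∧̇ PairIn v0 (suc k) (suc A) ∧̇ EqApp (suc x) (suc φ) v0)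
  collapse-at {k} {x} d = ∀E (⇒E (∀E (∧E₂ (∧E₂ (∧E₂ C))) k) d) x

value-⊆-hat : ∀ {A φ k w y : Fin n} → Γ ⊢ Collapse A φ → Γ ⊢ PairIn k w φ → Γ ⊢ y ∈̇ w → Γ ⊢ InHat y φ A k
value-⊆-hat C P m = obtain (⇔E₁ (collapse-at C (dom-intro P)) (app-intro P m)) λ t H →
  obtain (∧E₂ (∧E₂ H)) λ t′ H′ → hat-intro (t′ (∧E₁ (∧E₂ H))) (pairIn-subst₂ (≐-sym (∧E₂ H′)) (∧E₁ H′))

hat-⊆-value : ∀ {A φ k w y : Fin n} → Γ ⊢ Collapse A φ → Γ ⊢ PairIn k w φ → Γ ⊢ InHat y φ A k → Γ ⊢ y ∈̇ w
hat-⊆-value C P H = obtain (∧E₂ H) λ t H′ →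
  let jk = ∧E₁ H′
      jy = ∧E₂ H′
  in obtain (⇔E₂ (collapse-at (⇑Collapse t C) (dom-intro (t P)))
                 (∃I v0 (∧I (collapse-dom (⇑Collapse t C) (car-fst jk)) (∧I jk (eqApp-intro jy))))) λ t′ H″ →
     ∈-substʳ (func-unique (collapse-func (⇑Collapse t′ (⇑Collapse t C))) (∧E₁ H″) (t′ (t P))) (∧E₂ H″)

-- φ(k) = φ̂_A(k), read off from the collapse condition at k.
value-is-hat : ∀ {A φ k w : Fin n} → Γ ⊢ Collapse A φ → Γ ⊢ PairIn k w φ → Γ ⊢ EqHat w φ A k
value-is-hat C P =
  ∀I (⇔I (value-⊆-hat (⇑Collapse shift∃ C) (shift∃ P) hyp₀) (hat-⊆-value (⇑Collapse shift∃ C) (shift∃ P) hyp₀))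

-- Bisimilarity of pointed graphs versus equality of their reifications

Forth : Fin n → Fin n → Fin n → Fm n
Forth A B r =
  ∀̇ ∀̇ ∀̇ ((PairIn v1 v2 (↑ 3 A) ∧̇ PairIn v2 v0 (↑ 3 r)) ⇒̇ ∃̇ (PairIn v0 v1 (↑ 4 B) ∧̇ PairIn v2 v0 (↑ 4 r)))

Back : Fin n → Fin n → Fin n → Fm n
Back A B r =
  ∀̇ ∀̇ ∀̇ ((PairIn v1 v2 (↑ 3 B) ∧̇ PairIn v0 v2 (↑ 3 r)) ⇒̇ ∃̇ (PairIn v0 v1 (↑ 4 A) ∧̇ PairIn v0 v2 (↑ 4 r)))

HatRelated : (r φ A ψ B u w : Fin n) → Fm n
HatRelated r φ A ψ B u w =
  ∃̇ ∃̇ (PairIn v1 v0 (↑ 2 r) ∧̇ EqHat (↑ 2 u) (↑ 2 φ) (↑ 2 A) v1 ∧̇ EqHat (↑ 2 w) (↑ 2 ψ) (↑ 2 B) v0)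

record CollapsesOverBisim (Γ : Cx n) (r φ A ψ B : Fin n) : Set where
  field
    collapseˡ : Γ ⊢ Collapse A φ
    collapseʳ : Γ ⊢ Collapse B ψ
    forth     : Γ ⊢ Forth A B r
    back      : Γ ⊢ Back A B r

open CollapsesOverBisim

module _ {Γ : Cx n} {A B r : Fin n} where

  forth-elim : ∀ {i k j} → Γ ⊢ Forth A B r → Γ ⊢ PairIn k i A → Γ ⊢ PairIn i j r →
               Γ ⊢ ∃̇ (PairIn v0 (suc j) (suc B) ∧̇ PairIn (suc k) v0 (suc r))
  forth-elim {i} {k} {j} Fo ki ij = ⇒E (∀E (∀E (∀E Fo i) k) j) (∧I ki ij)

  back-elim : ∀ {j k i} → Γ ⊢ Back A B r → Γ ⊢ PairIn k j B → Γ ⊢ PairIn i j r →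
              Γ ⊢ ∃̇ (PairIn v0 (suc i) (suc A) ∧̇ PairIn v0 (suc k) (suc r))
  back-elim {j} {k} {i} Bk kj ij = ⇒E (∀E (∀E (∀E Bk j) k) i) (∧I kj ij)

module _ {Γ : Cx n} {r φ A ψ B : Fin n} where

  ⇑CollapsesOverBisim : ∀ {m} {ρ : Fin n → Fin m} {Δ : Cx m} → Transport ρ Γ Δ → CollapsesOverBisim Γ r φ A ψ B →
                        CollapsesOverBisim Δ (ρ r) (ρ φ) (ρ A) (ρ ψ) (ρ B)
  ⇑CollapsesOverBisim t S = record
    { collapseˡ = ⇑Collapse t (collapseˡ S)
    ; collapseʳ = ⇑Collapse t (collapseʳ S)
    ; forth     = t {Forth A B r} (forth S)
    ; back      = t {Back A B r} (back S)
    }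

  hatRelated-intro : ∀ {u w i j} → Γ ⊢ PairIn i j r → Γ ⊢ EqHat u φ A i → Γ ⊢ EqHat w ψ B j →
                     Γ ⊢ HatRelated r φ A ψ B u w
  hatRelated-intro {i = i} {j} P Eu Ew = ∃I i (∃I j (∧I P (∧I Eu Ew)))

hatRelated-forth : ∀ {r φ A ψ B x x′ y : Fin n} → CollapsesOverBisim Γ r φ A ψ B → Γ ⊢ x′ ∈̇ x →
                   Γ ⊢ HatRelated r φ A ψ B x y →
                   Γ ⊢ ∃̇ (v0 ∈̇ suc y ∧̇ HatRelated (suc r) (suc φ) (suc A) (suc ψ) (suc B) (suc x′) v0)
hatRelated-forth S x′∈x R =
  obtain R λ t₁ R₁ → obtain R₁ λ t₂ R₂ →
  let S₂ = ⇑CollapsesOverBisim t₂ (⇑CollapsesOverBisim t₁ S)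
  in obtain (eqHat-∈ (∧E₁ (∧E₂ R₂)) (t₂ (t₁ x′∈x))) λ t₃ K →
  let S₃ = ⇑CollapsesOverBisim t₃ S₂
  in obtain (forth-elim (forth S₃) (∧E₁ K) (t₃ (∧E₁ R₂))) λ t₄ J →
  let S₄ = ⇑CollapsesOverBisim t₄ S₃
  in obtain (collapse-dom (collapseʳ S₄) (car-fst (∧E₁ J))) λ t₅ Y →
  let S₅ = ⇑CollapsesOverBisim t₅ S₄
  in ∃I zero (∧I (eqHat-∋ (⇑EqHat t₅ (⇑EqHat t₄ (⇑EqHat t₃ (∧E₂ (∧E₂ R₂))))) (t₅ (∧E₁ J)) Y)
                 (hatRelated-intro (t₅ (∧E₂ J)) (value-is-hat (collapseˡ S₅) (t₅ (t₄ (∧E₂ K))))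
                                   (value-is-hat (collapseʳ S₅) Y)))

hatRelated-back : ∀ {r φ A ψ B y y′ x : Fin n} → CollapsesOverBisim Γ r φ A ψ B → Γ ⊢ y′ ∈̇ y →
                  Γ ⊢ HatRelated r φ A ψ B x y →
                  Γ ⊢ ∃̇ (v0 ∈̇ suc x ∧̇ HatRelated (suc r) (suc φ) (suc A) (suc ψ) (suc B) v0 (suc y′))
hatRelated-back S y′∈y R =
  obtain R λ t₁ R₁ → obtain R₁ λ t₂ R₂ →
  let S₂ = ⇑CollapsesOverBisim t₂ (⇑CollapsesOverBisim t₁ S)
  in obtain (eqHat-∈ (∧E₂ (∧E₂ R₂)) (t₂ (t₁ y′∈y))) λ t₃ K →
  let S₃ = ⇑CollapsesOverBisim t₃ S₂
  in obtain (back-elim (back S₃) (∧E₁ K) (t₃ (∧E₁ R₂))) λ t₄ I →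
  let S₄ = ⇑CollapsesOverBisim t₄ S₃
  in obtain (collapse-dom (collapseˡ S₄) (car-fst (∧E₁ I))) λ t₅ X →
  let S₅ = ⇑CollapsesOverBisim t₅ S₄
  in ∃I zero (∧I (eqHat-∋ (⇑EqHat t₅ (⇑EqHat t₄ (⇑EqHat t₃ (∧E₁ (∧E₂ R₂))))) (t₅ (∧E₁ I)) X)
                 (hatRelated-intro (t₅ (∧E₂ I)) (value-is-hat (collapseˡ S₅) X)
                                   (value-is-hat (collapseʳ S₅) (t₅ (t₄ (∧E₂ K))))))

-- Strong extensionality for HatRelated, a bisimulation by hatRelated-forth and hatRelated-back.
hatRelated-≐ : ∀ {r φ A ψ B x y : Fin n} → CollapsesOverBisim Γ r φ A ψ B →
               Γ ⊢ HatRelated r φ A ψ B x y → Γ ⊢ x ≐ y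
hatRelated-≐ {r = r} {φ} {A} {ψ} {B} {x} {y} S R =
  ⇒E (∀E (∀E (strong-ext-inst 5 (HatRelated v2 v3 v4 v5 v6 v0 v1) (r ∷ᵥ φ ∷ᵥ A ∷ᵥ ψ ∷ᵥ B ∷ᵥ []ᵥ)) x) y)
     (∧I R (∧I (∀I (∀I (∀I (⇒I (hatRelated-forth (⇑CollapsesOverBisim shift∀³⇒ S) (∧E₁ hyp₀) (∧E₂ hyp₀))))))
               (∀I (∀I (∀I (⇒I (hatRelated-back (⇑CollapsesOverBisim shift∀³⇒ S) (∧E₁ hyp₀) (∧E₂ hyp₀))))))))

record Reification (Γ : Cx n) (g x A a φ : Fin n) : Set where
  field
    pointed  : Γ ⊢ IsPair g A a
    collapse : Γ ⊢ Collapse A φ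
    root     : Γ ⊢ EqHat x φ A a

record BisimWitness (Γ : Cx n) (g h A a B b r : Fin n) : Set where
  field
    graphˡ   : Γ ⊢ Graph A
    graphʳ   : Γ ⊢ Graph B
    pointedˡ : Γ ⊢ IsPair g A a
    pointedʳ : Γ ⊢ IsPair h B b
    roots    : Γ ⊢ PairIn a b r
    forth    : Γ ⊢ Forth A B r
    back     : Γ ⊢ Back A B r

open Reification
open BisimWitness

module _ {m} {ρ : Fin n → Fin m} {Γ : Cx n} {Δ : Cx m} (t : Transport ρ Γ Δ) where

  ⇑Reification : ∀ {g x A a φ} → Reification Γ g x A a φ → Reification Δ (ρ g) (ρ x) (ρ A) (ρ a) (ρ φ)
  ⇑Reification R =
    record { pointed = t (pointed R) ; collapse = ⇑Collapse t (collapse R) ; root = ⇑EqHat t (root R) }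

reification-intro : ∀ {g x A a φ : Fin n} → Reification Γ g x A a φ → Γ ⊢ Reif g x
reification-intro {A = A} {a} {φ} R = ∃I A (∃I a (∃I φ (∧I (pointed R) (∧I (collapse R) (root R)))))

obtain-reification : ∀ {g x : Fin n} {C} → Γ ⊢ Reif g x →
  (∀ {Δ} → Transport (↑ 3) Γ Δ → Reification Δ (↑ 3 g) (↑ 3 x) v2 v1 v0 → Δ ⊢ wk (wk (wk C))) → Γ ⊢ C
obtain-reification d k = obtain d λ t₁ H₁ → obtain H₁ λ t₂ H₂ → obtain H₂ λ t₃ H₃ →
  k (t₃ ⊙ (t₂ ⊙ t₁)) (record { pointed = ∧E₁ H₃ ; collapse = ∧E₁ (∧E₂ H₃) ; root = ∧E₂ (∧E₂ H₃) })

bisim-intro : ∀ {g h A a B b r : Fin n} → BisimWitness Γ g h A a B b r → Γ ⊢ Bisim g h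
bisim-intro {A = A} {a} {B} {b} {r} W = ∃I A (∃I a (∃I B (∃I b (∃I r
  (∧I (graphˡ W) (∧I (graphʳ W) (∧I (pointedˡ W) (∧I (pointedʳ W) (∧I (roots W) (∧I (forth W) (back W)))))))))))

obtain-bisim : ∀ {g h : Fin n} {C} → Γ ⊢ Bisim g h →
  (∀ {Δ} → Transport (↑ 5) Γ Δ → BisimWitness Δ (↑ 5 g) (↑ 5 h) v4 v3 v2 v1 v0 → Δ ⊢ wk (wk (wk (wk (wk C))))) →
  Γ ⊢ C
obtain-bisim d k =
  obtain d λ t₁ H₁ → obtain H₁ λ t₂ H₂ → obtain H₂ λ t₃ H₃ → obtain H₃ λ t₄ H₄ → obtain H₄ λ t₅ H₅ →
  k (t₅ ⊙ (t₄ ⊙ (t₃ ⊙ (t₂ ⊙ t₁))))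
    (record { graphˡ = ∧E₁ H₅ ; graphʳ = ∧E₁ (∧E₂ H₅) ; pointedˡ = ∧E₁ (∧E₂ (∧E₂ H₅))
            ; pointedʳ = ∧E₁ (∧E₂ (∧E₂ (∧E₂ H₅))) ; roots = ∧E₁ (∧E₂ (∧E₂ (∧E₂ (∧E₂ H₅))))
            ; forth = ∧E₁ (∧E₂ (∧E₂ (∧E₂ (∧E₂ (∧E₂ H₅))))) ; back = ∧E₂ (∧E₂ (∧E₂ (∧E₂ (∧E₂ (∧E₂ H₅))))) })

module _ {Γ : Cx n} where

  collapse-subst : ∀ {A A′ φ} → Γ ⊢ A ≐ A′ → Γ ⊢ Collapse A φ → Γ ⊢ Collapse A′ φ
  collapse-subst {φ = φ} e d = ≐-subst (Collapse v0 (suc φ)) e d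

  eqHat-subst : ∀ {x φ A A′ a a′} → Γ ⊢ A ≐ A′ → Γ ⊢ a ≐ a′ → Γ ⊢ EqHat x φ A a → Γ ⊢ EqHat x φ A′ a′
  eqHat-subst {x} {φ} {A′ = A′} {a} e e′ d =
    ≐-subst (EqHat (suc x) (suc φ) (suc A′) v0) e′ (≐-subst (EqHat (suc x) (suc φ) v0 (suc a)) e d)

reifications-bisim-≐ : ∀ {g h x y A a φ B b ψ A′ a′ B′ b′ r : Fin n} →
                       Reification Γ g x A a φ → Reification Γ h y B b ψ → BisimWitness Γ g h A′ a′ B′ b′ r →
                       Γ ⊢ x ≐ y
reifications-bisim-≐ R₁ R₂ W =
  let A≐A′ = pair-inj₁ (pointed R₁) (pointedˡ W)
      a≐a′ = pair-inj₂ (pointed R₁) (pointedˡ W)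
      B≐B′ = pair-inj₁ (pointed R₂) (pointedʳ W)
      b≐b′ = pair-inj₂ (pointed R₂) (pointedʳ W)
  in hatRelated-≐
       (record { collapseˡ = collapse-subst A≐A′ (collapse R₁) ; collapseʳ = collapse-subst B≐B′ (collapse R₂)
               ; forth = forth W ; back = back W })
       (hatRelated-intro (roots W) (eqHat-subst A≐A′ a≐a′ (root R₁)) (eqHat-subst B≐B′ b≐b′ (root R₂)))

bisim-≐ : ∀ {g h x y : Fin n} → Γ ⊢ Reif g x → Γ ⊢ Reif h y → Γ ⊢ Bisim g h → Γ ⊢ x ≐ y
bisim-≐ rg rh b =
  obtain-reification rg λ t₁ R₁ → obtain-reification (⇑Reif t₁ rh) λ t₂ R₂ →
  obtain-bisim (⇑Bisim t₂ (⇑Bisim t₁ b)) λ t₃ W →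
  reifications-bisim-≐ (⇑Reification (t₃ ⊙ t₂) R₁) (⇑Reification t₃ R₂) W

SameHat : (φ A i ψ B j : Fin n) → Fm n
SameHat φ A i ψ B j = ∀̇ (InHat v0 (suc φ) (suc A) (suc i) ⇔̇ InHat v0 (suc ψ) (suc B) (suc j))

SameHatPair : (p φ A ψ B : Fin n) → Fm n
SameHatPair p φ A ψ B = ∃̇ ∃̇ (IsPair (↑ 2 p) v1 v0 ∧̇ SameHat (↑ 2 φ) (↑ 2 A) v1 (↑ 2 ψ) (↑ 2 B) v0)

IsSameHatRelation : (r S φ A ψ B : Fin n) → Fm n
IsSameHatRelation r S φ A ψ B = ∀̇ (v0 ∈̇ suc r ⇔̇ (v0 ∈̇ suc S ∧̇ SameHatPair v0 (suc φ) (suc A) (suc ψ) (suc B)))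

sameHatRelation-exists : ∀ (S φ A ψ B : Fin n) →
                         Γ ⊢ ∃̇ IsSameHatRelation v0 (suc S) (suc φ) (suc A) (suc ψ) (suc B)
sameHatRelation-exists S φ A ψ B = ∀E (compr-inst 4 (SameHatPair v0 v1 v2 v3 v4) (φ ∷ᵥ A ∷ᵥ ψ ∷ᵥ B ∷ᵥ []ᵥ)) S

record SameHatSetting (Γ : Cx n) (r S U φ A ψ B : Fin n) : Set where
  field
    collapseˡ : Γ ⊢ Collapse A φ
    collapseʳ : Γ ⊢ Collapse B ψ
    relation  : Γ ⊢ IsSameHatRelation r S φ A ψ B
    square    : Γ ⊢ U ²⊆̇ S
    boundˡ    : Γ ⊢ ⋃⋃ A ⊆̇ U
    boundʳ    : Γ ⊢ ⋃⋃ B ⊆̇ U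

open SameHatSetting

⇑SameHatSetting : ∀ {m} {ρ : Fin n → Fin m} {Δ : Cx m} {r S U φ A ψ B : Fin n} → Transport ρ Γ Δ →
                  SameHatSetting Γ r S U φ A ψ B → SameHatSetting Δ (ρ r) (ρ S) (ρ U) (ρ φ) (ρ A) (ρ ψ) (ρ B)
⇑SameHatSetting {r = r} {S} {U} {φ} {A} {ψ} {B} t H = record
  { collapseˡ = ⇑Collapse t (collapseˡ H)
  ; collapseʳ = ⇑Collapse t (collapseʳ H)
  ; relation  = t {IsSameHatRelation r S φ A ψ B} (relation H)
  ; square    = t {U ²⊆̇ S} (square H)
  ; boundˡ    = t {⋃⋃ A ⊆̇ U} (boundˡ H)
  ; boundʳ    = t {⋃⋃ B ⊆̇ U} (boundʳ H)
  }

module _ {Γ : Cx n} {φ A ψ B : Fin n} where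

  eqHats-sameHat : ∀ {w i j} → Γ ⊢ EqHat w φ A i → Γ ⊢ EqHat w ψ B j → Γ ⊢ SameHat φ A i ψ B j
  eqHats-sameHat E₁ E₂ = ∀I (⇔-trans (⇔-sym (∀E (⇑EqHat shift E₁) v0)) (∀E (⇑EqHat shift E₂) v0))

  sameHat-subst : ∀ {i i′ j j′} → Γ ⊢ i′ ≐ i → Γ ⊢ j′ ≐ j → Γ ⊢ SameHat φ A i′ ψ B j′ → Γ ⊢ SameHat φ A i ψ B j
  sameHat-subst {i} {j′ = j′} e e′ d =
    ≐-subst (SameHat (suc φ) (suc A) (suc i) (suc ψ) (suc B) v0) e′
            (≐-subst (SameHat (suc φ) (suc A) v0 (suc ψ) (suc B) (suc j′)) e d)

sameHatRelation-elim : ∀ {r S U φ A ψ B : Fin n} {i j} → SameHatSetting Γ r S U φ A ψ B →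
                       Γ ⊢ PairIn i j r → Γ ⊢ SameHat φ A i ψ B j
sameHatRelation-elim H P = obtain P λ t₁ H₁ →
  obtain (∧E₂ (⇔E₁ (∀E (relation (⇑SameHatSetting t₁ H)) v0) (∧E₂ H₁))) λ t₂ H₂ → obtain H₂ λ t₃ H₃ →
  let P′ = (t₃ ⊙ t₂) (∧E₁ H₁)
  in sameHat-subst (≐-sym (pair-inj₁ P′ (∧E₁ H₃))) (≐-sym (pair-inj₂ P′ (∧E₁ H₃))) (∧E₂ H₃)

sameHatRelation-intro : ∀ {r S U φ A ψ B : Fin n} {i j} → SameHatSetting Γ r S U φ A ψ B →
                        Γ ⊢ i ∈̇ U → Γ ⊢ j ∈̇ U → Γ ⊢ SameHat φ A i ψ B j → Γ ⊢ PairIn i j r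
sameHatRelation-intro {i = i} {j} H i∈U j∈U e = obtain (pair-exists i j) λ t P →
  let H′ = ⇑SameHatSetting t H
  in pairIn-intro P (⇔E₂ (∀E (relation H′) v0)
                          (∧I (²⊆̇-elim (square H′) (t i∈U) (t j∈U) P) (∃I (suc i) (∃I (suc j) (∧I P (t e))))))

sameHat-forth : ∀ {r S U φ A ψ B : Fin n} {x′ x y} → SameHatSetting Γ r S U φ A ψ B →
                Γ ⊢ PairIn x′ x A → Γ ⊢ PairIn x y r →
                Γ ⊢ ∃̇ (PairIn v0 (suc y) (suc B) ∧̇ PairIn (suc x′) v0 (suc r))
sameHat-forth H x′x xy = obtain (collapse-dom (collapseˡ H) (car-fst x′x)) λ t₁ W →
  let H₁ = ⇑SameHatSetting t₁ H
  in obtain (∧E₂ (⇔E₁ (∀E (sameHatRelation-elim H₁ (t₁ xy)) v0) (hat-intro (t₁ x′x) W))) λ t₂ J →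
  let H₂ = ⇑SameHatSetting t₂ H₁
  in ∃I zero (∧I (∧E₁ J)
       (sameHatRelation-intro H₂ (⋃⋃⊆̇-elim (boundˡ H₂) (pairIn-⋃⋃₁ ((t₂ ⊙ t₁) x′x)))
                                 (⋃⋃⊆̇-elim (boundʳ H₂) (pairIn-⋃⋃₁ (∧E₁ J)))
                                 (eqHats-sameHat (value-is-hat (collapseˡ H₂) (t₂ W))
                                                 (value-is-hat (collapseʳ H₂) (∧E₂ J)))))

sameHat-back : ∀ {r S U φ A ψ B : Fin n} {y′ y x} → SameHatSetting Γ r S U φ A ψ B →
               Γ ⊢ PairIn y′ y B → Γ ⊢ PairIn x y r →
               Γ ⊢ ∃̇ (PairIn v0 (suc x) (suc A) ∧̇ PairIn v0 (suc y′) (suc r))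
sameHat-back H y′y xy = obtain (collapse-dom (collapseʳ H) (car-fst y′y)) λ t₁ W →
  let H₁ = ⇑SameHatSetting t₁ H
  in obtain (∧E₂ (⇔E₂ (∀E (sameHatRelation-elim H₁ (t₁ xy)) v0) (hat-intro (t₁ y′y) W))) λ t₂ I →
  let H₂ = ⇑SameHatSetting t₂ H₁
  in ∃I zero (∧I (∧E₁ I)
       (sameHatRelation-intro H₂ (⋃⋃⊆̇-elim (boundˡ H₂) (pairIn-⋃⋃₁ (∧E₁ I)))
                                 (⋃⋃⊆̇-elim (boundʳ H₂) (pairIn-⋃⋃₁ ((t₂ ⊙ t₁) y′y)))
                                 (eqHats-sameHat (value-is-hat (collapseˡ H₂) (∧E₂ I))
                                                 (value-is-hat (collapseʳ H₂) (t₂ W)))))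

sameHat-bisimWitness : ∀ {g h x y A a φ B b ψ r S U : Fin n} →
                       Reification Γ g x A a φ → Reification Γ h y B b ψ → Γ ⊢ x ≐ y →
                       SameHatSetting Γ r S U φ A ψ B → Γ ⊢ a ∈̇ U → Γ ⊢ b ∈̇ U → BisimWitness Γ g h A a B b r
sameHat-bisimWitness {A = A} {a} {φ} R₁ R₂ x≐y H a∈U b∈U = record
  { graphˡ   = ∧E₁ (collapse R₁)
  ; graphʳ   = ∧E₁ (collapse R₂)
  ; pointedˡ = pointed R₁
  ; pointedʳ = pointed R₂
  ; roots    = sameHatRelation-intro H a∈U b∈U
                 (eqHats-sameHat (≐-subst (EqHat v0 (suc φ) (suc A) (suc a)) x≐y (root R₁)) (root R₂))
  ; forth    = ∀I (∀I (∀I (⇒I (sameHat-forth (⇑SameHatSetting shift∀³⇒ H) (∧E₁ hyp₀) (∧E₂ hyp₀)))))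
  ; back     = ∀I (∀I (∀I (⇒I (sameHat-back (⇑SameHatSetting shift∀³⇒ H) (∧E₁ hyp₀) (∧E₂ hyp₀)))))
  }

-- U contains both carriers and both roots, so r can be carved out of a set S ⊇ U × U by comprehension.
reifications-bisim : ∀ {g h x y A a φ B b ψ : Fin n} →
                     Reification Γ g x A a φ → Reification Γ h y B b ψ → Γ ⊢ x ≐ y → Γ ⊢ Bisim g h
reifications-bisim {A = A} {a} {φ} {B} {b} {ψ} R₁ R₂ x≐y =
  obtain (bound-exists A B a b) λ t₁ U → obtain (square-superset-exists v0) λ t₂ S →
  obtain (sameHatRelation-exists v0 (↑ 2 φ) (↑ 2 A) (↑ 2 ψ) (↑ 2 B)) λ t₃ r →
  let t = t₃ ⊙ (t₂ ⊙ t₁)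
      U′ = (t₃ ⊙ t₂) U
  in bisim-intro (sameHat-bisimWitness (⇑Reification t R₁) (⇑Reification t R₂) (t x≐y)
       (record { collapseˡ = ⇑Collapse t (collapse R₁) ; collapseʳ = ⇑Collapse t (collapse R₂)
               ; relation = r ; square = t₃ S ; boundˡ = ∧E₁ U′ ; boundʳ = ∧E₁ (∧E₂ U′) })
       (∧E₁ (∧E₂ (∧E₂ U′))) (∧E₂ (∧E₂ (∧E₂ U′))))

≐-bisim : ∀ {g h x y : Fin n} → Γ ⊢ Reif g x → Γ ⊢ Reif h y → Γ ⊢ x ≐ y → Γ ⊢ Bisim g h
≐-bisim rg rh x≐y =
  obtain-reification rg λ t₁ R₁ → obtain-reification (⇑Reif t₁ rh) λ t₂ R₂ →
  reifications-bisim (⇑Reification t₂ R₁) R₂ ((t₂ ⊙ t₁) x≐y)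

≐-iff-bisim : ∀ {g h x y : Fin n} → Γ ⊢ Reif g x → Γ ⊢ Reif h y → Γ ⊢ (x ≐ y) ⇔̇ Bisim g h
≐-iff-bisim rg rh = ⇔I (≐-bisim (weaken₁ rg) (weaken₁ rh) hyp₀) (bisim-≐ (weaken₁ rg) (weaken₁ rh) hyp₀)

mem-intro : ∀ {g h A a z p : Fin n} → Γ ⊢ IsPair h A a → Γ ⊢ PairIn z a A → Γ ⊢ IsPair p A z → Γ ⊢ Bisim g p →
            Γ ⊢ MemT g h
mem-intro {A = A} {a} {z} {p} hA za pA gp = ∃I A (∃I a (∧I hA (∃I z (∧I za (∃I p (∧I pA gp))))))

child-reification : ∀ {h y B b ψ p z w : Fin n} → Reification Γ h y B b ψ → Γ ⊢ IsPair p B z → Γ ⊢ PairIn z w ψ →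
                    Reification Γ p w B z ψ
child-reification R P W = record { pointed = P ; collapse = collapse R ; root = value-is-hat (collapse R) W }

∈-memT : ∀ {g h x y : Fin n} → Γ ⊢ Reif g x → Γ ⊢ Reif h y → Γ ⊢ x ∈̇ y → Γ ⊢ MemT g h
∈-memT rg rh x∈y =
  obtain-reification rh λ t R → obtain (eqHat-∈ (root R) (t x∈y)) λ t₁ Z → obtain (pair-exists v3 v0) λ t₂ P →
  let R′ = ⇑Reification (t₂ ⊙ t₁) R
  in mem-intro (pointed R′) (t₂ (∧E₁ Z)) P
       (≐-bisim (⇑Reif (t₂ ⊙ (t₁ ⊙ t)) rg) (reification-intro (child-reification R′ P (t₂ (∧E₂ Z)))) (≐-refl _))

child-bisim-∈ : ∀ {g h x y B b ψ A a z p : Fin n} → Γ ⊢ Reif g x → Reification Γ h y B b ψ →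
                Γ ⊢ IsPair h A a → Γ ⊢ PairIn z a A → Γ ⊢ IsPair p A z → Γ ⊢ Bisim g p → Γ ⊢ x ∈̇ y
child-bisim-∈ {z = z} {p} rg R hA za pA gp =
  let B≐A = pair-inj₁ (pointed R) hA
      zb = pairIn-subst₃ (≐-sym B≐A) (pairIn-subst₂ (≐-sym (pair-inj₂ (pointed R) hA)) za)
      pB = ≐-subst (IsPair (suc p) v0 (suc z)) (≐-sym B≐A) pA
  in obtain (collapse-dom (collapse R) (car-fst zb)) λ t W →
     let x≐w = bisim-≐ (⇑Reif t rg) (reification-intro (child-reification (⇑Reification t R) (t pB) W)) (⇑Bisim t gp)
     in ∈-substˡ (≐-sym x≐w) (eqHat-∋ (⇑EqHat t (root R)) (t zb) W)

memT-∈ : ∀ {g h x y : Fin n} → Γ ⊢ Reif g x → Γ ⊢ Reif h y → Γ ⊢ MemT g h → Γ ⊢ x ∈̇ y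
memT-∈ rg rh m =
  obtain-reification rh λ t R →
  obtain (⇑MemT t m) λ t₁ H₁ → obtain H₁ λ t₂ H₂ → obtain (∧E₂ H₂) λ t₃ H₃ → obtain (∧E₂ H₃) λ t₄ H₄ →
  let t′ = t₄ ⊙ (t₃ ⊙ (t₂ ⊙ t₁))
  in child-bisim-∈ (⇑Reif (t′ ⊙ t) rg) (⇑Reification t′ R) ((t₄ ⊙ t₃) (∧E₁ H₂)) (t₄ (∧E₁ H₃)) (∧E₁ H₄) (∧E₂ H₄)

∈-iff-memT : ∀ {g h x y : Fin n} → Γ ⊢ Reif g x → Γ ⊢ Reif h y → Γ ⊢ (x ∈̇ y) ⇔̇ MemT g h
∈-iff-memT rg rh = ⇔I (∈-memT (weaken₁ rg) (weaken₁ rh) hyp₀) (memT-∈ (weaken₁ rg) (weaken₁ rh) hyp₀)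

-- Every set has a reification

IsTransitive : Fin n → Fm n
IsTransitive e = ∀̇ ∀̇ ((v1 ∈̇ v0 ∧̇ v0 ∈̇ ↑ 2 e) ⇒̇ v1 ∈̇ ↑ 2 e)

MembershipEdge : Fin n → Fin n → Fm n
MembershipEdge p e = ∃̇ ∃̇ (IsPair (↑ 2 p) v1 v0 ∧̇ v1 ∈̇ v0 ∧̇ v0 ∈̇ ↑ 2 e)

IdentityPair : Fin n → Fin n → Fm n
IdentityPair p A = ∃̇ (IsPair (suc p) v0 v0 ∧̇ InCar v0 (suc A))

IsMembershipGraph : (A S e : Fin n) → Fm n
IsMembershipGraph A S e = ∀̇ (v0 ∈̇ suc A ⇔̇ (v0 ∈̇ suc S ∧̇ MembershipEdge v0 (suc e)))

IsIdentityOnCar : (φ S A : Fin n) → Fm n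
IsIdentityOnCar φ S A = ∀̇ (v0 ∈̇ suc φ ⇔̇ (v0 ∈̇ suc S ∧̇ IdentityPair v0 (suc A)))

membership-graph-exists : ∀ (S e : Fin n) → Γ ⊢ ∃̇ IsMembershipGraph v0 (suc S) (suc e)
membership-graph-exists S e = ∀E (compr-inst 1 (MembershipEdge v0 v1) (e ∷ᵥ []ᵥ)) S

identity-on-car-exists : ∀ (S A : Fin n) → Γ ⊢ ∃̇ IsIdentityOnCar v0 (suc S) (suc A)
identity-on-car-exists S A = ∀E (compr-inst 1 (IdentityPair v0 v1) (A ∷ᵥ []ᵥ)) S

transitive-closure-exists : ∀ (a : Fin n) → Γ ⊢ ∃̇ (suc a ⊆̇ v0 ∧̇ IsTransitive v0)
transitive-closure-exists a = ∀E (ax trans-cl) a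

record MembershipSetting (Γ : Cx n) (e S A φ : Fin n) : Set where
  field
    transitive : Γ ⊢ IsTransitive e
    square     : Γ ⊢ e ²⊆̇ S
    graph      : Γ ⊢ IsMembershipGraph A S e
    identity   : Γ ⊢ IsIdentityOnCar φ S A

open MembershipSetting

⇑MembershipSetting : ∀ {m} {ρ : Fin n → Fin m} {Δ : Cx m} {e S A φ : Fin n} → Transport ρ Γ Δ →
                     MembershipSetting Γ e S A φ → MembershipSetting Δ (ρ e) (ρ S) (ρ A) (ρ φ)
⇑MembershipSetting {e = e} {S} {A} {φ} t M = record
  { transitive = t {IsTransitive e} (transitive M)
  ; square     = t {e ²⊆̇ S} (square M)
  ; graph      = t {IsMembershipGraph A S e} (graph M)
  ; identity   = t {IsIdentityOnCar φ S A} (identity M)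
  }

transitive-∈ : ∀ {e u v : Fin n} → Γ ⊢ IsTransitive e → Γ ⊢ u ∈̇ v → Γ ⊢ v ∈̇ e → Γ ⊢ u ∈̇ e
transitive-∈ {u = u} {v} T u∈v v∈e = ⇒E (∀E (∀E T u) v) (∧I u∈v v∈e)

edge-∈ : ∀ {e S A φ j i : Fin n} → MembershipSetting Γ e S A φ → Γ ⊢ PairIn j i A → Γ ⊢ j ∈̇ i ∧̇ i ∈̇ e
edge-∈ M P = obtain P λ t₁ H₁ →
  obtain (∧E₂ (⇔E₁ (∀E (graph (⇑MembershipSetting t₁ M)) v0) (∧E₂ H₁))) λ t₂ H₂ → obtain H₂ λ t₃ H₃ →
  let P′ = (t₃ ⊙ t₂) (∧E₁ H₁)
      j≐u = pair-inj₁ P′ (∧E₁ H₃)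
      i≐v = pair-inj₂ P′ (∧E₁ H₃)
  in ∧I (∈-subst₂ (≐-sym j≐u) (≐-sym i≐v) (∧E₁ (∧E₂ H₃))) (∈-substˡ (≐-sym i≐v) (∧E₂ (∧E₂ H₃)))

∈-edge : ∀ {e S A φ j i : Fin n} → MembershipSetting Γ e S A φ → Γ ⊢ j ∈̇ i → Γ ⊢ i ∈̇ e → Γ ⊢ PairIn j i A
∈-edge {j = j} {i = i} M j∈i i∈e = obtain (pair-exists j i) λ t P →
  let M′ = ⇑MembershipSetting t M
      j∈e = t (transitive-∈ (transitive M) j∈i i∈e)
  in pairIn-intro P (⇔E₂ (∀E (graph M′) v0)
       (∧I (²⊆̇-elim (square M′) j∈e (t i∈e) P) (∃I (suc j) (∃I (suc i) (∧I P (∧I (t j∈i) (t i∈e)))))))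

car-⊆ : ∀ {e S A φ u : Fin n} → MembershipSetting Γ e S A φ → Γ ⊢ InCar u A → Γ ⊢ u ∈̇ e
car-⊆ M c = obtain (∧E₂ c) λ t H →
  ∨E H (let M′ = ⇑MembershipSetting (weaken₁ᵗ t) M
        in transitive-∈ (transitive M′) (∧E₁ (edge-∈ M′ hyp₀)) (∧E₂ (edge-∈ M′ hyp₀)))
       (∧E₂ (edge-∈ (⇑MembershipSetting (weaken₁ᵗ t) M) hyp₀))

identity-elim : ∀ {e S A φ i y : Fin n} → MembershipSetting Γ e S A φ → Γ ⊢ PairIn i y φ → Γ ⊢ y ≐ i ∧̇ InCar i A
identity-elim {A = A} M P = obtain P λ t₁ H₁ →
  obtain (∧E₂ (⇔E₁ (∀E (identity (⇑MembershipSetting t₁ M)) v0) (∧E₂ H₁))) λ t₂ H₂ →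
  let P′ = t₂ (∧E₁ H₁)
      i≐u = pair-inj₁ P′ (∧E₁ H₂)
  in ∧I (≐-trans (pair-inj₂ P′ (∧E₁ H₂)) (≐-sym i≐u)) (≐-subst (InCar v0 (↑ 2 (suc A))) (≐-sym i≐u) (∧E₂ H₂))

car-identity : ∀ {e S A φ i : Fin n} → MembershipSetting Γ e S A φ → Γ ⊢ InCar i A → Γ ⊢ PairIn i i φ
car-identity {i = i} M c = obtain (pair-exists i i) λ t P →
  let M′ = ⇑MembershipSetting t M
      i∈e = t (car-⊆ M c)
  in pairIn-intro P (⇔E₂ (∀E (identity M′) v0) (∧I (²⊆̇-elim (square M′) i∈e i∈e P) (∃I (suc i) (∧I P (t c)))))

app-children : ∀ {e S A φ i z : Fin n} → MembershipSetting Γ e S A φ → Γ ⊢ InApp z φ i →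
               Γ ⊢ ∃̇ (InDom v0 (suc φ) ∧̇ PairIn v0 (suc i) (suc A) ∧̇ EqApp (suc z) (suc φ) v0)
app-children {z = z} M m = obtain m λ t H →
  let M′ = ⇑MembershipSetting t M
      I = identity-elim M′ (∧E₁ H)
      z-i = ∈-edge M′ (∈-substʳ (∧E₁ I) (∧E₂ H)) (car-⊆ M′ (∧E₂ I))
      z-z = car-identity M′ (car-fst z-i)
  in ∃I (suc z) (∧I (dom-intro z-z) (∧I z-i (eqApp-intro z-z)))

children-app : ∀ {e S A φ i z : Fin n} → MembershipSetting Γ e S A φ →
               Γ ⊢ ∃̇ (InDom v0 (suc φ) ∧̇ PairIn v0 (suc i) (suc A) ∧̇ EqApp (suc z) (suc φ) v0) → Γ ⊢ InApp z φ i
children-app M H = obtain H λ t₁ H₁ → obtain (∧E₂ (∧E₂ H₁)) λ t₂ H₂ →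
  let M′ = ⇑MembershipSetting (t₂ ⊙ t₁) M
      j-i = t₂ (∧E₁ (∧E₂ H₁))
      z≐j = ≐-trans (∧E₂ H₂) (∧E₁ (identity-elim M′ (∧E₁ H₂)))
  in app-intro (car-identity M′ (car-snd j-i)) (∈-substˡ (≐-sym z≐j) (∧E₁ (edge-∈ M′ j-i)))

membership-isGraph : ∀ {e S A φ : Fin n} → MembershipSetting Γ e S A φ → Γ ⊢ Graph A
membership-isGraph M =
  ∀I (⇒I (obtain (∧E₂ (⇔E₁ (∀E (graph (⇑MembershipSetting shift∃ M)) v0) hyp₀)) λ t H → obtain H λ t′ H′ →
    ∃I v1 (∃I v0 (∧E₁ H′))))

identity-isFunc : ∀ {e S A φ : Fin n} → MembershipSetting Γ e S A φ → Γ ⊢ Func φ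
identity-isFunc M =
  ∧I (∀I (⇒I (obtain (∧E₂ (⇔E₁ (∀E (identity (⇑MembershipSetting shift∃ M)) v0) hyp₀)) λ t H →
       ∃I v0 (∃I v0 (∧E₁ H)))))
     (∀I (∀I (∀I (⇒I (let M³ = ⇑MembershipSetting shift∀³⇒ M
                      in ≐-trans (∧E₁ (identity-elim M³ (∧E₁ hyp₀)))
                                 (≐-sym (∧E₁ (identity-elim M³ (∧E₂ hyp₀)))))))))

identity-dom : ∀ {e S A φ : Fin n} → MembershipSetting Γ e S A φ → Γ ⊢ ∀̇ (InDom v0 (suc φ) ⇔̇ InCar v0 (suc A))
identity-dom M = ∀I (⇔I (obtain hyp₀ λ t H → ∧E₂ (identity-elim (⇑MembershipSetting (t ⊙ shift∃) M) H))
                        (∃I v0 (car-identity (⇑MembershipSetting shift∃ M) hyp₀)))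

identity-condition : ∀ {e S A φ : Fin n} → MembershipSetting Γ e S A φ →
  Γ ⊢ ∀̇ (InDom v0 (suc φ) ⇒̇
         ∀̇ (InApp v0 (↑ 2 φ) v1 ⇔̇ ∃̇ (InDom v0 (↑ 3 φ) ∧̇ PairIn v0 v2 (↑ 3 A) ∧̇ EqApp v1 (↑ 3 φ) v0)))
identity-condition M = ∀I (⇒I (∀I (⇔I (app-children (⇑MembershipSetting (shift∃ ⊙ shift∃) M) hyp₀)
                                      (children-app (⇑MembershipSetting (shift∃ ⊙ shift∃) M) hyp₀))))

membership-collapse : ∀ {e S A φ : Fin n} → MembershipSetting Γ e S A φ → Γ ⊢ Collapse A φ
membership-collapse M =
  ∧I (membership-isGraph M) (∧I (identity-isFunc M) (∧I (identity-dom M) (identity-condition M)))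

membership-root : ∀ {e S A φ x : Fin n} → MembershipSetting Γ e S A φ → Γ ⊢ x ∈̇ e → Γ ⊢ EqHat x φ A x
membership-root M x∈e = ∀I (⇔I
  (let y-x = ∈-edge (⇑MembershipSetting shift∃ M) hyp₀ (shift∃ x∈e)
   in hat-intro y-x (car-identity (⇑MembershipSetting shift∃ M) (car-fst y-x)))
  (obtain (∧E₂ hyp₀) λ t H →
   let M′ = ⇑MembershipSetting (t ⊙ shift∃) M
   in ∈-substˡ (≐-sym (∧E₁ (identity-elim M′ (∧E₂ H)))) (∧E₁ (edge-∈ M′ (∧E₁ H)))))

-- ⟨A, x⟩ reifies x, where A is the membership relation on a transitive set containing x and φ is the identity.
reification-exists : ∀ (x : Fin n) → Γ ⊢ ∃̇ Reif v0 (suc x)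
reification-exists x =
  obtain (singleton-exists x) λ t₁ s → obtain (transitive-closure-exists v0) λ t₂ E →
  obtain (square-superset-exists v0) λ t₃ S → obtain (membership-graph-exists v0 v1) λ t₄ A →
  obtain (identity-on-car-exists v1 v0) λ t₅ φ → obtain (pair-exists v1 (↑ 5 x)) λ t₆ g →
  let M = ⇑MembershipSetting t₆ (record { transitive = (t₅ ⊙ (t₄ ⊙ t₃)) (∧E₂ E) ; square = (t₅ ⊙ t₄) S
                                        ; graph = t₅ A ; identity = φ })
      x∈e = (t₆ ⊙ (t₅ ⊙ (t₄ ⊙ t₃))) (⊆̇-elim (∧E₁ E) (t₂ (sing-∈ s)))
  in ∃I v0 (reification-intro
              (record { pointed = g ; collapse = membership-collapse M ; root = membership-root M x∈e }))

-- The translation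

module _ {Γ : Cx n} where

  ⇔-refl : ∀ {A} → Γ ⊢ A ⇔̇ A
  ⇔-refl = ⇔I hyp₀ hyp₀

  ⇔-∧ : ∀ {A A′ B B′} → Γ ⊢ A ⇔̇ A′ → Γ ⊢ B ⇔̇ B′ → Γ ⊢ (A ∧̇ B) ⇔̇ (A′ ∧̇ B′)
  ⇔-∧ a b = ⇔I (∧I (⇔E₁ (weaken₁ a) (∧E₁ hyp₀)) (⇔E₁ (weaken₁ b) (∧E₂ hyp₀)))
               (∧I (⇔E₂ (weaken₁ a) (∧E₁ hyp₀)) (⇔E₂ (weaken₁ b) (∧E₂ hyp₀)))

  ⇔-∨ : ∀ {A A′ B B′} → Γ ⊢ A ⇔̇ A′ → Γ ⊢ B ⇔̇ B′ → Γ ⊢ (A ∨̇ B) ⇔̇ (A′ ∨̇ B′)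
  ⇔-∨ a b = ⇔I (∨E hyp₀ (∨I₁ (⇔E₁ (weaken₁ (weaken₁ a)) hyp₀)) (∨I₂ (⇔E₁ (weaken₁ (weaken₁ b)) hyp₀)))
               (∨E hyp₀ (∨I₁ (⇔E₂ (weaken₁ (weaken₁ a)) hyp₀)) (∨I₂ (⇔E₂ (weaken₁ (weaken₁ b)) hyp₀)))

  ⇔-⇒ : ∀ {A A′ B B′} → Γ ⊢ A ⇔̇ A′ → Γ ⊢ B ⇔̇ B′ → Γ ⊢ (A ⇒̇ B) ⇔̇ (A′ ⇒̇ B′)
  ⇔-⇒ a b = ⇔I (⇒I (⇔E₁ (weaken₁ (weaken₁ b)) (⇒E (weaken₁ hyp₀) (⇔E₂ (weaken₁ (weaken₁ a)) hyp₀))))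
               (⇒I (⇔E₂ (weaken₁ (weaken₁ b)) (⇒E (weaken₁ hyp₀) (⇔E₁ (weaken₁ (weaken₁ a)) hyp₀))))

Reifies : ∀ {k} → Cx n → (Fin k → Fin n) → (Fin k → Fin n) → Set
Reifies Γ ρg ρx = ∀ i → Γ ⊢ Reif (ρg i) (ρx i)

⇑Reifies : ∀ {k m} {ρ : Fin n → Fin m} {Δ : Cx m} {ρg ρx : Fin k → Fin n} → Transport ρ Γ Δ →
           Reifies Γ ρg ρx → Reifies Δ (λ i → ρ (ρg i)) (λ i → ρ (ρx i))
⇑Reifies t Rs i = ⇑Reif t (Rs i)

∷-Reifies : ∀ {k} {g x : Fin n} {ρg ρx : Fin k → Fin n} → Γ ⊢ Reif g x → Reifies Γ ρg ρx →
            Reifies Γ (g ∷ᵥ ρg) (x ∷ᵥ ρx)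
∷-Reifies R Rs zero    = R
∷-Reifies R Rs (suc i) = Rs i

_⁺⁺ : ∀ {k} → (Fin k → Fin n) → Fin k → Fin (suc (suc n))
(ρ ⁺⁺) i = suc (suc (ρ i))

wk-ren-ext : ∀ {k} (ρ : Fin k → Fin n) (Q : Fm (suc k)) → wk (ren (ext ρ) Q) ≡ ren (v1 ∷ᵥ ρ ⁺⁺) Q
wk-ren-ext ρ Q = ren-fusion (λ { zero → refl ; (suc i) → refl }) Q

inst-wk²-ren-ext : ∀ {k} (ρ : Fin k → Fin n) (Q : Fm (suc k)) →
                   inst (ren (ext suc) (ren (ext suc) (ren (ext ρ) Q))) zero ≡ ren (v0 ∷ᵥ ρ ⁺⁺) Q
inst-wk²-ren-ext ρ Q =
  trans (ren-fusion (λ _ → refl) (ren (ext suc) (ren (ext ρ) Q)))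
        (trans (ren-fusion (λ _ → refl) (ren (ext ρ) Q)) (ren-fusion (λ { zero → refl ; (suc i) → refl }) Q))

dag-correct : ∀ {k} (P : Fm k) {ρg ρx : Fin k → Fin n} → Reifies Γ ρg ρx → Γ ⊢ ren ρx P ⇔̇ ren ρg (dag P)
dag-correct (x ≐ y) Rs = ≐-iff-bisim (Rs x) (Rs y)
dag-correct (x ∈̇ y) Rs = ∈-iff-memT (Rs x) (Rs y)
dag-correct ⊤̇       Rs = ⇔-refl
dag-correct ⊥̇       Rs = ⇔-refl
dag-correct (A ∧̇ B) Rs = ⇔-∧ (dag-correct A Rs) (dag-correct B Rs)
dag-correct (A ∨̇ B) Rs = ⇔-∨ (dag-correct A Rs) (dag-correct B Rs)
dag-correct (A ⇒̇ B) Rs = ⇔-⇒ (dag-correct A Rs) (dag-correct B Rs)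
dag-correct (∀̇ Q) {ρg} {ρx} Rs = ⇔I
  (∀I (⇒I (obtain hyp₀ λ t R →
    let IH = dag-correct Q (∷-Reifies R (⇑Reifies (t ⊙ shift∃) (λ i → weaken₁ (Rs i))))
        Qx = cast (inst-wk²-ren-ext ρx Q) (∀E (t (weaken₁ hyp₀)) zero)
    in cast (sym (wk-ren-ext ρg (dag Q))) (⇔E₁ IH Qx))))
  (∀I (obtain (reification-exists v0) λ t R →
    let IH = dag-correct Q (∷-Reifies R (⇑Reifies (t ⊙ shift∃) Rs))
        Qg = cast (inst-wk²-ren-ext ρg (dag Q)) (⇒E (∀E (t hyp₀) zero) (∃I v1 R))
    in cast (sym (wk-ren-ext ρx Q)) (⇔E₂ IH Qg)))
dag-correct (∃̇ Q) {ρg} {ρx} Rs = ⇔I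
  (obtain hyp₀ λ t X → obtain (reification-exists v0) λ t′ R →
    let IH = dag-correct Q (∷-Reifies R (⇑Reifies (t′ ⊙ t) (λ i → weaken₁ (Rs i))))
    in ∃I v0 (∧I (∃I v1 R) (cast (sym (inst-wk²-ren-ext ρg (dag Q))) (⇔E₁ IH (cast (wk-ren-ext ρx Q) (t′ X))))))
  (obtain hyp₀ λ t X → obtain (∧E₁ X) λ t′ R →
    let IH = dag-correct Q (∷-Reifies R (⇑Reifies (t′ ⊙ t) (λ i → weaken₁ (Rs i))))
    in ∃I v0 (cast (sym (inst-wk²-ren-ext ρx Q)) (⇔E₂ IH (cast (wk-ren-ext ρg (dag Q)) (t′ (∧E₂ X))))))

closeAll-intro : ∀ k (A : Fm k) → [] ⊢ A → [] ⊢ closeAll k A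
closeAll-intro zero    A d = d
closeAll-intro (suc k) A d = closeAll-intro k (∀̇ A) (∀I d)

⋀-elim : ∀ {k} (f : Fin k → Fm n) → Γ ⊢ ⋀ f → ∀ i → Γ ⊢ f i
⋀-elim f d zero    = ∧E₁ d
⋀-elim f d (suc i) = ⋀-elim (λ j → f (suc j)) (∧E₂ d) i

proposition14 : (n : ℕ) (P : Fm n) → Theorem (Prop14Formula n P)
proposition14 n P = closeAll-intro (n + n) _ (⇒I (dag-correct P (⋀-elim (λ i → Reif (n ↑ʳ i) (i ↑ˡ n)) hyp₀)))
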